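{- Let $\mathcal{H}(0)$, $\mathbb{Z}[\Lambda]$, $D_s$ and the matrix of $\mathscr{A}(0)(U)$ be as in the context. The ring homomorphism $$\mathscr{A}(0):\mathcal{H}(0)\to \mathrm{End}_{\mathbb{Z}[\Lambda]^s}(\mathbb{Z}[\Lambda])$$ determined by - $S\mapsto -D_s$, and - $U\mapsto$ the $\mathbb{Z}[\Lambda]^s$-linear endomorphism whose matrix is given in the context, is injective.
   Context: Let $\mathcal{H}(0)$ be the $\mathbb{Z}$-algebra generated by $S$, $U$, $U^{ -1}$ with relations $$UU^{ -1}=U^{ -1}U=1,\qquad S^2=-S,\qquad U^2S=SU^2.$$ This is the specialization at $\mathbf{q}=0$ of the generic Iwahori–Hecke algebra. Let $\Lambda=\mathbb{Z}^2$ with basis $\eta_1=(1,0)$, $\eta_2=(0,1)$, and let $s$ swap the two coordinates. Let $\mathbb{Z}[\Lambda]=\mathbb{Z}[e^{\pm\eta_1},e^{\pm\eta_2}]$ be the group ring with the induced $s$-action. Then $\mathbb{Z}[\Lambda]^s=\mathbb{Z}[\xi_1,\xi_2^{\pm1}]$ with $$\xi_1=e^{(1,0)}+e^{(0,1)},\qquad \xi_2=e^{(1,1)}.$$ The module $\mathbb{Z}[\Lambda]$ is free over $\mathbb{Z}[\Lambda]^s$ with basis $\{1,e^{(-1,0)}\}$. The Demazure operator is $D_s(a)=\dfrac{a-s(a)}{1-e^{(1,-1)}}$. In the basis $\{1,e^{(-1,0)}\}$, with columns giving the images of the basis vectors, $\mathscr{A}(0)(U)$ has matrix $$\begin{pmatrix}\xi_1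 & e^{(-1,-1)}\xi_1^2-1\\ -e^{(1,1)} & -\xi_1\end{pmatrix}.$$ In this basis, $-D_s$ has matrix $\begin{pmatrix}0&0\\0&-1\end{pmatrix}$. This $\mathscr{A}(0)$ is the specialization at $\mathbf{q}=0$ of the unique extension of the Demazure representation $S\mapsto -D_s(\mathbf{q})$ to the generic Iwahori–Hecke algebra which sends the central elements $U(S+1)+SU$ and $U^2$ to $\xi_1$ and $\xi_2$, respectively. -}

module Defs where

open import Data.Integer using (ℤ; +_; -_; _+_; _*_; _≟_)
open import Data.Product using (_×_; _,_)
open import Data.List using (List; []; _∷_; _++_; map; concatMap)
open import Data.Bool using (_∧_; if_then_else_)
open import Relation.Nullary.Decidable using (⌊_⌋)
open import Relation.Binary.PropositionalEquality using (_≡_)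

-- The group ring ℤ[Λ], Λ = ℤ², i.e. Laurent polynomials in e^{η₁}, e^{η₂}.
-- An element is a finite formal sum (list of (coefficient , exponent));
-- two elements are equal iff all their coefficients agree.

Exp : Set
Exp = ℤ × ℤ

ZΛ : Set
ZΛ = List (ℤ × Exp)

_≟E_ : Exp → Exp → Data.Bool.Bool
(a , b) ≟E (c , d) = ⌊ a ≟ c ⌋ ∧ ⌊ b ≟ d ⌋

coeff : ZΛ → Exp → ℤ
coeff [] m = + 0
coeff ((c , e) ∷ p) m = (if e ≟E m then c else + 0) + coeff p m

_≈Λ_ : ZΛ → ZΛ → Set
p ≈Λ q = ∀ m → coeff p m ≡ coeff q m

e^ : ℤ → ℤ → ZΛ
e^ a b = (+ 1 , (a , b)) ∷ []

0Λ 1Λ : ZΛ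
0Λ = []
1Λ = e^ (+ 0) (+ 0)

_+Λ_ : ZΛ → ZΛ → ZΛ
p +Λ q = p ++ q

-Λ_ : ZΛ → ZΛ
-Λ p = map (λ { (c , e) → (- c , e) }) p

_-Λ_ : ZΛ → ZΛ → ZΛ
p -Λ q = p +Λ (-Λ q)

_*Λ_ : ZΛ → ZΛ → ZΛ
p *Λ q = concatMap (λ { (c , (a , b)) →
           map (λ { (d , (a' , b')) → (c * d , (a + a' , b + b')) }) q }) p

infixl 6 _+Λ_ _-Λ_
infixl 7 _*Λ_

ξ₁ ξ₂ : ZΛ
ξ₁ = e^ (+ 1) (+ 0) +Λ e^ (+ 0) (+ 1)
ξ₂ = e^ (+ 1) (+ 1)

-- ℤ[Λ]^s-linear endomorphisms of ℤ[Λ], written as 2×2 matrices in the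
-- ℤ[Λ]^s-basis {1, e^{(-1,0)}} (columns = images of basis vectors).
-- Entries are taken in ℤ[Λ] (they are s-invariant); composition of
-- endomorphisms is matrix multiplication.

record M2 : Set where
  constructor mat
  field
    a₁₁ a₁₂ a₂₁ a₂₂ : ZΛ
open M2 public

_≈M_ : M2 → M2 → Set
M ≈M N = (a₁₁ M ≈Λ a₁₁ N) × (a₁₂ M ≈Λ a₁₂ N) × (a₂₁ M ≈Λ a₂₁ N) × (a₂₂ M ≈Λ a₂₂ N)

0M 1M : M2
0M = mat 0Λ 0Λ 0Λ 0Λ
1M = mat 1Λ 0Λ 0Λ 1Λ

_+M_ : M2 → M2 → M2
mat a b c d +M mat a' b' c' d' = mat (a +Λ a') (b +Λ b') (c +Λ c') (d +Λ d')

-M_ : M2 → M2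
-M (mat a b c d) = mat (-Λ a) (-Λ b) (-Λ c) (-Λ d)

_*M_ : M2 → M2 → M2
mat a b c d *M mat a' b' c' d' =
  mat (a *Λ a' +Λ b *Λ c') (a *Λ b' +Λ b *Λ d')
      (c *Λ a' +Λ d *Λ c') (c *Λ b' +Λ d *Λ d')

minusDs : M2
minusDs = mat 0Λ 0Λ 0Λ (-Λ 1Λ)

AU : M2
AU = mat ξ₁ (e^ (- + 1) (- + 1) *Λ ξ₁ *Λ ξ₁ -Λ 1Λ)
         (-Λ e^ (+ 1) (+ 1)) (-Λ ξ₁)

-- its inverse 𝒜(0)(U⁻¹) (det AU = -e^{(1,1)}; inverse = -e^{(-1,-1)}·adj AU)
AUinv : M2
AUinv = mat (e^ (- + 1) (- + 1) *Λ ξ₁)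
            (e^ (- + 2) (- + 2) *Λ ξ₁ *Λ ξ₁ -Λ e^ (- + 1) (- + 1))
            (-Λ 1Λ) (-Λ (e^ (- + 1) (- + 1) *Λ ξ₁))

-- Presented as ring terms modulo the congruence generated by the
-- (unital, associative, not necessarily commutative) ring axioms and
-- the defining relations.

data HTerm : Set where
  S U U⁻¹ : HTerm
  𝟘 𝟙     : HTerm
  _⊕_ _⊗_ : HTerm → HTerm → HTerm
  ⊖_      : HTerm → HTerm

infixl 6 _⊕_
infixl 7 _⊗_
infix 8 ⊖_
infix 4 _∼_

data _∼_ : HTerm → HTerm → Set where
  ∼-refl  : ∀ {x} → x ∼ x
  ∼-sym   : ∀ {x y} → x ∼ y → y ∼ x
  ∼-trans : ∀ {x y z} → x ∼ y → y ∼ z → x ∼ z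
  ⊕-cong  : ∀ {x x' y y'} → x ∼ x' → y ∼ y' → x ⊕ y ∼ x' ⊕ y'
  ⊗-cong  : ∀ {x x' y y'} → x ∼ x' → y ∼ y' → x ⊗ y ∼ x' ⊗ y'
  ⊖-cong  : ∀ {x x'} → x ∼ x' → ⊖ x ∼ ⊖ x'
  ⊕-assoc     : ∀ x y z → (x ⊕ y) ⊕ z ∼ x ⊕ (y ⊕ z)
  ⊕-comm      : ∀ x y → x ⊕ y ∼ y ⊕ x
  ⊕-identityˡ : ∀ x → 𝟘 ⊕ x ∼ x
  ⊖-inverseˡ  : ∀ x → (⊖ x) ⊕ x ∼ 𝟘
  ⊗-assoc     : ∀ x y z → (x ⊗ y) ⊗ z ∼ x ⊗ (y ⊗ z)
  ⊗-identityˡ : ∀ x → 𝟙 ⊗ x ∼ x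
  ⊗-identityʳ : ∀ x → x ⊗ 𝟙 ∼ x
  distribˡ    : ∀ x y z → x ⊗ (y ⊕ z) ∼ (x ⊗ y) ⊕ (x ⊗ z)
  distribʳ    : ∀ x y z → (y ⊕ z) ⊗ x ∼ (y ⊗ x) ⊕ (z ⊗ x)
  rel-UU⁻¹ : U ⊗ U⁻¹ ∼ 𝟙
  rel-U⁻¹U : U⁻¹ ⊗ U ∼ 𝟙
  rel-SS   : S ⊗ S ∼ ⊖ S
  rel-UUS  : (U ⊗ U) ⊗ S ∼ S ⊗ (U ⊗ U)

𝒜₀ : HTerm → M2
𝒜₀ S       = minusDs
𝒜₀ U       = AU
𝒜₀ U⁻¹     = AUinv
𝒜₀ 𝟘       = 0M
𝒜₀ 𝟙       = 1M
𝒜₀ (x ⊕ y) = 𝒜₀ x +M 𝒜₀ y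
𝒜₀ (x ⊗ y) = 𝒜₀ x *M 𝒜₀ y
𝒜₀ (⊖ x)   = -M (𝒜₀ x)

{-# OPTIONS --safe #-}
module Submission where

-- Modulo its relations every element of ℋ(0) is 1·a + S·b + U·c + SU·d with a, b, c, d
-- polynomials in the central elements z₁ = U(S+1) + SU, z₂ = U² and z₂⁻¹, because left
-- multiplication by S, U and U⁻¹ acts on such coordinates by explicit matrices.
-- 𝒜(0) sends z₁, z₂ to ξ₁, ξ₂ and 1, S, U, SU to matrices whose entries show that they are
-- linearly independent over ℤ[Λ]; one entry is a multiple of e^{(1,-1)} + 1 + e^{(-1,1)},
-- which is not a zero divisor. Hence 𝒜(0)x = 𝒜(0)y forces the coordinates of x − y to vanish
-- in ℤ[Λ]. They then vanish in ℋ(0) too: the additive map e^{(a,b)} ↦ z₂^b h(a − b), where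
-- h(k+1) + z₂h(k−1) = z₁h(k), h(0) = 1, h(−1) = 0, is linear over the polynomials in
-- z₁, z₂^{±1} and sends 1 to 1, so it recovers every such polynomial from its value in ℤ[Λ].

open import Defs hiding (distribˡ; distribʳ)

open import Algebra.Bundles using (AbelianGroup; Semiring; Ring)
open import Data.Bool using (Bool; true; false; _∧_; if_then_else_)
open import Data.Integer using (ℤ; +_; -[1+_]; _≟_; _≤ᵇ_)
  renaming (_+_ to _+ℤ_; _*_ to _*ℤ_; _-_ to _-ℤ_; -_ to -ℤ_)
import Data.Integer.Properties as ℤ
open import Data.Integer.Tactic.RingSolver using (solve-∀)
open import Data.List using ([]; _∷_; _++_; map; length; foldr)
import Data.List.Properties as List
open import Data.Nat as ℕ using (ℕ; zero; suc; s≤s)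
import Data.Nat.Properties as ℕ
open import Data.Product using (_×_; _,_)
open import Function using (mk⇔)
open import Relation.Nullary using (contradiction)
open import Relation.Nullary.Decidable using (⌊_⌋; yes; no; isYes≗does; does-⇔; dec-true)
open import Relation.Binary.PropositionalEquality as ≡
  using (_≡_; refl; cong; cong₂)

_+E_ _-E_ : Exp → Exp → Exp
(a , b) +E (c , d) = (a +ℤ c , b +ℤ d)
(a , b) -E (c , d) = (a -ℤ c , b -ℤ d)

≟E-sound : ∀ {e m} → (e ≟E m) ≡ true → e ≡ m
≟E-sound {a , b} {c , d} eq with a ≟ c | b ≟ d | eq
... | yes refl | yes refl | _ = refl
... | no _     | _        | ()
... | yes _    | no _     | ()

≟E-refl : ∀ e → (e ≟E e) ≡ true
≟E-refl (a , b) = cong₂ _∧_ (≟-refl a) (≟-refl b)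
  where
  ≟-refl : ∀ x → ⌊ x ≟ x ⌋ ≡ true
  ≟-refl x = ≡.trans (isYes≗does (x ≟ x)) (dec-true (x ≟ x) refl)

≟E-shift : ∀ v e m → ((v +E e) ≟E m) ≡ (e ≟E (m -E v))
≟E-shift (a , b) (c , d) (m , n) = cong₂ _∧_ (shift a c m) (shift b d n)
  where
  shift : ∀ x y z → ⌊ x +ℤ y ≟ z ⌋ ≡ ⌊ y ≟ z -ℤ x ⌋
  shift x y z = begin
    ⌊ x +ℤ y ≟ z ⌋     ≡⟨ isYes≗does (x +ℤ y ≟ z) ⟩
    _                 ≡⟨ does-⇔ (mk⇔ to from) (x +ℤ y ≟ z) (y ≟ z -ℤ x) ⟩
    _                 ≡⟨ isYes≗does (y ≟ z -ℤ x) ⟨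
    ⌊ y ≟ z -ℤ x ⌋     ∎
    where
    open ≡.≡-Reasoning
    to : x +ℤ y ≡ z → y ≡ z -ℤ x
    to refl = cancel x y
      where cancel : ∀ x y → y ≡ x +ℤ y -ℤ x
            cancel = solve-∀
    from : y ≡ z -ℤ x → x +ℤ y ≡ z
    from refl = cancel x z
      where cancel : ∀ x z → x +ℤ (z -ℤ x) ≡ z
            cancel = solve-∀

infix 4 _≋_

-- _≈Λ_ wrapped in a record, so that both sides can be inferred from a proof.
record _≋_ (p q : ZΛ) : Set where
  constructor coeffwise
  field same-coeff : p ≈Λ q
open _≋_ public

coeff-+Λ : ∀ p q m → coeff (p +Λ q) m ≡ coeff p m +ℤ coeff q m
coeff-+Λ []            q m = ≡.sym (ℤ.+-identityˡ (coeff q m))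
coeff-+Λ ((c , e) ∷ p) q m = ≡.trans (cong (λ k → (if e ≟E m then c else + 0) +ℤ k) (coeff-+Λ p q m))
  (≡.sym (ℤ.+-assoc (if e ≟E m then c else + 0) (coeff p m) (coeff q m)))

coeff--Λ : ∀ p m → coeff (-Λ p) m ≡ -ℤ coeff p m
coeff--Λ []            m = refl
coeff--Λ ((c , e) ∷ p) m = ≡.trans (cong₂ _+ℤ_ (if-neg (e ≟E m)) (coeff--Λ p m))
  (≡.sym (ℤ.neg-distrib-+ (if e ≟E m then c else + 0) (coeff p m)))
  where
  if-neg : ∀ b → (if b then -ℤ c else + 0) ≡ -ℤ (if b then c else + 0)
  if-neg true  = refl
  if-neg false = refl

≋-refl : ∀ {p} → p ≋ p
≋-refl = coeffwise λ _ → refl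

≋-sym : ∀ {p q} → p ≋ q → q ≋ p
≋-sym (coeffwise p≈q) = coeffwise λ m → ≡.sym (p≈q m)

≋-trans : ∀ {p q r} → p ≋ q → q ≋ r → p ≋ r
≋-trans (coeffwise p≈q) (coeffwise q≈r) = coeffwise λ m → ≡.trans (p≈q m) (q≈r m)

≡⇒≋ : ∀ {p q} → p ≡ q → p ≋ q
≡⇒≋ refl = ≋-refl

+Λ-cong : ∀ {p p′ q q′} → p ≋ p′ → q ≋ q′ → p +Λ q ≋ p′ +Λ q′
+Λ-cong {p} {p′} {q} {q′} (coeffwise p≈p′) (coeffwise q≈q′) = coeffwise λ m →
  ≡.trans (coeff-+Λ p q m) (≡.trans (cong₂ _+ℤ_ (p≈p′ m) (q≈q′ m)) (≡.sym (coeff-+Λ p′ q′ m)))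

+Λ-congˡ : ∀ p {q q′} → q ≋ q′ → p +Λ q ≋ p +Λ q′
+Λ-congˡ p = +Λ-cong (≋-refl {p})

+Λ-congʳ : ∀ {p p′} q → p ≋ p′ → p +Λ q ≋ p′ +Λ q
+Λ-congʳ q p≋p′ = +Λ-cong p≋p′ (≋-refl {q})

-Λ-cong : ∀ {p p′} → p ≋ p′ → -Λ p ≋ -Λ p′
-Λ-cong {p} {p′} (coeffwise p≈p′) = coeffwise λ m →
  ≡.trans (coeff--Λ p m) (≡.trans (cong -ℤ_ (p≈p′ m)) (≡.sym (coeff--Λ p′ m)))

+Λ-comm : ∀ p q → p +Λ q ≋ q +Λ p
+Λ-comm p q = coeffwise λ m →
  ≡.trans (coeff-+Λ p q m) (≡.trans (ℤ.+-comm (coeff p m) (coeff q m)) (≡.sym (coeff-+Λ q p m)))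

-Λ-inverseˡ : ∀ p → (-Λ p) +Λ p ≋ 0Λ
-Λ-inverseˡ p = coeffwise λ m →
  ≡.trans (coeff-+Λ (-Λ p) p m) (≡.trans (cong (_+ℤ coeff p m) (coeff--Λ p m)) (ℤ.+-inverseˡ (coeff p m)))

-Λ-inverseʳ : ∀ p → p +Λ (-Λ p) ≋ 0Λ
-Λ-inverseʳ p = ≋-trans (+Λ-comm p (-Λ p)) (-Λ-inverseˡ p)

ℤΛ-+-abelianGroup : AbelianGroup _ _
ℤΛ-+-abelianGroup = record
  { Carrier = ZΛ ; _≈_ = _≋_ ; _∙_ = _+Λ_ ; ε = 0Λ ; _⁻¹ = -Λ_
  ; isAbelianGroup = record
    { isGroup = record
      { isMonoid = record
        { isSemigroup = record
          { isMagma = record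
            { isEquivalence = record { refl = ≋-refl ; sym = ≋-sym ; trans = ≋-trans }
            ; ∙-cong = +Λ-cong }
          ; assoc = λ p q r → ≡⇒≋ (List.++-assoc p q r) }
        ; identity = (λ _ → ≋-refl) , (λ p → ≡⇒≋ (List.++-identityʳ p)) }
      ; inverse = -Λ-inverseˡ , -Λ-inverseʳ
      ; ⁻¹-cong = -Λ-cong }
    ; comm = +Λ-comm } }

module Extension {c ℓ} (G : AbelianGroup c ℓ) (f : ℤ → Exp → AbelianGroup.Carrier G)
  (f-+ : ∀ c d e → AbelianGroup._≈_ G (f (c +ℤ d) e) (AbelianGroup._∙_ G (f c e) (f d e))) where

  open AbelianGroup G renaming (refl to ≈-refl)

  open import Algebra.Properties.AbelianGroup G
  open import Algebra.Properties.CommutativeSemigroup commutativeSemigroup using (x∙yz≈y∙xz)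
  open import Relation.Binary.Reasoning.Setoid setoid

  extend : ZΛ → Carrier
  extend []            = ε
  extend ((c , e) ∷ p) = f c e ∙ extend p

  f-0 : ∀ e → f (+ 0) e ≈ ε
  f-0 e = identityʳ-unique _ _ (sym (f-+ (+ 0) (+ 0) e))

  f-neg : ∀ c e → f (-ℤ c) e ≈ f c e ⁻¹
  f-neg c e = inverseˡ-unique _ _ (begin
    f (-ℤ c) e ∙ f c e  ≈⟨ f-+ (-ℤ c) c e ⟨
    f (-ℤ c +ℤ c) e      ≡⟨ cong (λ k → f k e) (ℤ.+-inverseˡ c) ⟩
    f (+ 0) e          ≈⟨ f-0 e ⟩
    ε                  ∎)

  extend-+Λ : ∀ p q → extend (p +Λ q) ≈ extend p ∙ extend q
  extend-+Λ []            q = sym (identityˡ _)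
  extend-+Λ ((c , e) ∷ p) q = trans (∙-congˡ (extend-+Λ p q)) (sym (assoc _ _ _))

  extend--Λ : ∀ p → extend (-Λ p) ≈ extend p ⁻¹
  extend--Λ []            = sym ε⁻¹≈ε
  extend--Λ ((c , e) ∷ p) = trans (∙-cong (f-neg c e) (extend--Λ p)) (⁻¹-∙-comm _ _)

  without : Exp → ZΛ → ZΛ
  without e []             = []
  without e ((c , e′) ∷ p) = if e′ ≟E e then without e p else (c , e′) ∷ without e p

  length-without : ∀ e p → length (without e p) ℕ.≤ length p
  length-without e []             = ℕ.z≤n
  length-without e ((c , e′) ∷ p) with e′ ≟E e
  ... | true  = ℕ.m≤n⇒m≤1+n (length-without e p)
  ... | false = s≤s (length-without e p)

  coeff-without : ∀ e p m → coeff (without e p) m ≡ (if e ≟E m then + 0 else coeff p m)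
  coeff-without e []             m with e ≟E m
  ... | true  = refl
  ... | false = refl
  coeff-without e ((c , e′) ∷ p) m with e′ ≟E e in e′≟e | e ≟E m in e≟m | coeff-without e p m
  ... | true  | true  | eq = eq
  ... | true  | false | eq with refl ← ≟E-sound {e′} {e} e′≟e rewrite e≟m = ≡.trans eq (≡.sym (ℤ.+-identityˡ _))
  ... | false | true  | eq with refl ← ≟E-sound {e} {m} e≟m rewrite e′≟e = ≡.trans (ℤ.+-identityˡ _) eq
  ... | false | false | eq = cong (_+ℤ_ (if e′ ≟E m then c else + 0)) eq

  extend-split : ∀ e p → extend p ≈ f (coeff p e) e ∙ extend (without e p)
  extend-split e []             = sym (trans (∙-congʳ (f-0 e)) (identityˡ ε))
  extend-split e ((c , e′) ∷ p) with e′ ≟E e in e′≟e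
  ... | true with refl ← ≟E-sound {e′} {e} e′≟e = begin
    f c e ∙ extend p                                ≈⟨ ∙-congˡ (extend-split e p) ⟩
    f c e ∙ (f (coeff p e) e ∙ extend (without e p)) ≈⟨ assoc _ _ _ ⟨
    (f c e ∙ f (coeff p e) e) ∙ extend (without e p) ≈⟨ ∙-congʳ (f-+ c (coeff p e) e) ⟨
    f (c +ℤ coeff p e) e ∙ extend (without e p)       ∎
  ... | false = begin
    f c e′ ∙ extend p                                  ≈⟨ ∙-congˡ (extend-split e p) ⟩
    f c e′ ∙ (f (coeff p e) e ∙ extend (without e p))   ≈⟨ x∙yz≈y∙xz _ _ _ ⟩
    f (coeff p e) e ∙ (f c e′ ∙ extend (without e p))   ≡⟨ cong (λ k → f k e ∙ (f c e′ ∙ extend (without e p))) (ℤ.+-identityˡ _) ⟨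
    f (+ 0 +ℤ coeff p e) e ∙ (f c e′ ∙ extend (without e p)) ∎

  without-self : ∀ c e p → without e ((c , e) ∷ p) ≡ without e p
  without-self c e p rewrite ≟E-refl e = refl

  extend-vanishes : ∀ p → (∀ m → coeff p m ≡ + 0) → extend p ≈ ε
  extend-vanishes p = bounded (length p) p ℕ.≤-refl
    where
    bounded : ∀ n p → length p ℕ.≤ n → (∀ m → coeff p m ≡ + 0) → extend p ≈ ε
    bounded _       []            _           _   = ≈-refl
    bounded (suc n) ((c , e) ∷ p) (s≤s |p|≤n) p≈0 = begin
      extend ((c , e) ∷ p)                                         ≈⟨ extend-split e ((c , e) ∷ p) ⟩
      f (coeff ((c , e) ∷ p) e) e ∙ extend (without e ((c , e) ∷ p)) ≡⟨ cong (λ r → _ ∙ extend r) (without-self c e p) ⟩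
      f (coeff ((c , e) ∷ p) e) e ∙ extend (without e p)           ≈⟨ ∙-cong head≈ε rest≈ε ⟩
      ε ∙ ε                                                        ≈⟨ identityˡ ε ⟩
      ε                                                            ∎
      where
      head≈ε : f (coeff ((c , e) ∷ p) e) e ≈ ε
      head≈ε = trans (reflexive (cong (λ k → f k e) (p≈0 e))) (f-0 e)
      rest-vanishes : ∀ m → coeff (without e p) m ≡ + 0
      rest-vanishes m with e ≟E m | ≡.subst (λ r → coeff r m ≡ _) (without-self c e p) (coeff-without e ((c , e) ∷ p) m) | p≈0 m
      ... | true  | eq | _    = eq
      ... | false | eq | p≈0′ = ≡.trans eq p≈0′
      rest≈ε : extend (without e p) ≈ ε
      rest≈ε = bounded n (without e p) (ℕ.≤-trans (length-without e p) |p|≤n) rest-vanishes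

  extend-cong : ∀ {p q} → p ≋ q → extend p ≈ extend q
  extend-cong {p} {q} p≋q = x∙y⁻¹≈ε⇒x≈y _ _ (begin
    extend p ∙ extend q ⁻¹    ≈⟨ ∙-congˡ (extend--Λ q) ⟨
    extend p ∙ extend (-Λ q)  ≈⟨ extend-+Λ p (-Λ q) ⟨
    extend (p +Λ -Λ q)        ≈⟨ extend-vanishes (p +Λ -Λ q) (same-coeff p-q≋0) ⟩
    ε                         ∎)
    where
    p-q≋0 : p +Λ -Λ q ≋ 0Λ
    p-q≋0 = ≋-trans (+Λ-congʳ (-Λ q) p≋q) (-Λ-inverseʳ q)

infixl 7 _·ₘ_
_·ₘ_ : ℤ × Exp → ℤ × Exp → ℤ × Exp
(c , v) ·ₘ (d , e) = (c *ℤ d , v +E e)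

coeff-map-·ₘ : ∀ c v q m → coeff (map ((c , v) ·ₘ_) q) m ≡ c *ℤ coeff q (m -E v)
coeff-map-·ₘ c v []            m = ≡.sym (ℤ.*-zeroʳ c)
coeff-map-·ₘ c v ((d , e) ∷ q) m = begin
  (if (v +E e) ≟E m then c *ℤ d else + 0) +ℤ coeff (map ((c , v) ·ₘ_) q) m
    ≡⟨ cong₂ _+ℤ_ (cong (λ b → if b then c *ℤ d else + 0) (≟E-shift v e m)) (coeff-map-·ₘ c v q m) ⟩
  (if e ≟E (m -E v) then c *ℤ d else + 0) +ℤ c *ℤ coeff q (m -E v)
    ≡⟨ cong (_+ℤ c *ℤ coeff q (m -E v)) (if-*ˡ (e ≟E (m -E v))) ⟩
  c *ℤ (if e ≟E (m -E v) then d else + 0) +ℤ c *ℤ coeff q (m -E v)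
    ≡⟨ ℤ.*-distribˡ-+ c _ _ ⟨
  c *ℤ coeff ((d , e) ∷ q) (m -E v) ∎
  where
  open ≡.≡-Reasoning
  if-*ˡ : ∀ b → (if b then c *ℤ d else + 0) ≡ c *ℤ (if b then d else + 0)
  if-*ˡ true  = refl
  if-*ˡ false = ≡.sym (ℤ.*-zeroʳ c)

module Convolution (q : ZΛ) (m : Exp) =
  Extension ℤ.+-0-abelianGroup (λ c e → c *ℤ coeff q (m -E e))
                               (λ c d e → ℤ.*-distribʳ-+ (coeff q (m -E e)) c d)

coeff-*Λ : ∀ p q m → coeff (p *Λ q) m ≡ Convolution.extend q m p
coeff-*Λ []            q m = refl
coeff-*Λ ((c , v) ∷ p) q m =
  ≡.trans (coeff-+Λ (map ((c , v) ·ₘ_) q) (p *Λ q) m)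
          (cong₂ _+ℤ_ (coeff-map-·ₘ c v q m) (coeff-*Λ p q m))

*Λ-congˡ : ∀ {p p′} q → p ≋ p′ → p *Λ q ≋ p′ *Λ q
*Λ-congˡ {p} {p′} q p≋p′ = coeffwise λ m → begin
  coeff (p *Λ q) m             ≡⟨ coeff-*Λ p q m ⟩
  Convolution.extend q m p     ≡⟨ Convolution.extend-cong q m p≋p′ ⟩
  Convolution.extend q m p′    ≡⟨ coeff-*Λ p′ q m ⟨
  coeff (p′ *Λ q) m            ∎
  where open ≡.≡-Reasoning

*Λ-congʳ : ∀ p {q q′} → q ≋ q′ → p *Λ q ≋ p *Λ q′
*Λ-congʳ []            q≋q′ = ≋-refl
*Λ-congʳ ((c , v) ∷ p) {q} {q′} q≋q′ = +Λ-cong map-cong (*Λ-congʳ p q≋q′)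
  where
  map-cong : map ((c , v) ·ₘ_) q ≋ map ((c , v) ·ₘ_) q′
  map-cong = coeffwise λ m → ≡.trans (coeff-map-·ₘ c v q m)
    (≡.trans (cong (c *ℤ_) (same-coeff q≋q′ (m -E v))) (≡.sym (coeff-map-·ₘ c v q′ m)))

*Λ-distribʳ : ∀ p q r → (p +Λ q) *Λ r ≡ p *Λ r +Λ q *Λ r
*Λ-distribʳ []      q r = refl
*Λ-distribʳ (t ∷ p) q r =
  ≡.trans (cong (map (t ·ₘ_) r ++_) (*Λ-distribʳ p q r)) (≡.sym (List.++-assoc (map (t ·ₘ_) r) (p *Λ r) (q *Λ r)))

*Λ-distribˡ : ∀ p q r → p *Λ (q +Λ r) ≋ p *Λ q +Λ p *Λ r
*Λ-distribˡ []      q r = ≋-refl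
*Λ-distribˡ (t ∷ p) q r = begin
  map (t ·ₘ_) (q ++ r) ++ p *Λ (q ++ r)                    ≡⟨ cong (_++ p *Λ (q ++ r)) (List.map-++ (t ·ₘ_) q r) ⟩
  (map (t ·ₘ_) q ++ map (t ·ₘ_) r) ++ p *Λ (q ++ r)        ≈⟨ +Λ-congˡ (map (t ·ₘ_) q ++ map (t ·ₘ_) r) (*Λ-distribˡ p q r) ⟩
  (map (t ·ₘ_) q ++ map (t ·ₘ_) r) ++ (p *Λ q ++ p *Λ r)   ≈⟨ interchange (map (t ·ₘ_) q) (map (t ·ₘ_) r) (p *Λ q) (p *Λ r) ⟩
  (map (t ·ₘ_) q ++ p *Λ q) ++ (map (t ·ₘ_) r ++ p *Λ r)   ∎
  where
  open AbelianGroup ℤΛ-+-abelianGroup using (commutativeSemigroup; setoid)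
  open import Algebra.Properties.CommutativeSemigroup commutativeSemigroup using (interchange)
  open import Relation.Binary.Reasoning.Setoid setoid

·ₘ-assoc : ∀ s t u → (s ·ₘ t) ·ₘ u ≡ s ·ₘ (t ·ₘ u)
·ₘ-assoc (c , (a , b)) (d , (a′ , b′)) (e , (a″ , b″)) =
  cong₂ _,_ (ℤ.*-assoc c d e) (cong₂ _,_ (ℤ.+-assoc a a′ a″) (ℤ.+-assoc b b′ b″))

*Λ-assoc : ∀ p q r → (p *Λ q) *Λ r ≡ p *Λ (q *Λ r)
*Λ-assoc []      q r = refl
*Λ-assoc (s ∷ p) q r = begin
  (map (s ·ₘ_) q ++ p *Λ q) *Λ r               ≡⟨ *Λ-distribʳ (map (s ·ₘ_) q) (p *Λ q) r ⟩
  map (s ·ₘ_) q *Λ r ++ (p *Λ q) *Λ r          ≡⟨ cong₂ _++_ (map-·ₘ-*Λ q) (*Λ-assoc p q r) ⟩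
  map (s ·ₘ_) (q *Λ r) ++ p *Λ (q *Λ r)        ∎
  where
  open ≡.≡-Reasoning
  map-·ₘ-*Λ : ∀ q → map (s ·ₘ_) q *Λ r ≡ map (s ·ₘ_) (q *Λ r)
  map-·ₘ-*Λ []      = refl
  map-·ₘ-*Λ (t ∷ q) = begin
    map ((s ·ₘ t) ·ₘ_) r ++ map (s ·ₘ_) q *Λ r       ≡⟨ cong₂ _++_ (List.map-cong (·ₘ-assoc s t) r) (map-·ₘ-*Λ q) ⟩
    map (λ u → s ·ₘ (t ·ₘ u)) r ++ map (s ·ₘ_) (q *Λ r) ≡⟨ cong (_++ map (s ·ₘ_) (q *Λ r)) (List.map-∘ r) ⟩
    map (s ·ₘ_) (map (t ·ₘ_) r) ++ map (s ·ₘ_) (q *Λ r) ≡⟨ List.map-++ (s ·ₘ_) (map (t ·ₘ_) r) (q *Λ r) ⟨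
    map (s ·ₘ_) (map (t ·ₘ_) r ++ q *Λ r)              ∎

*Λ-identityˡ : ∀ p → 1Λ *Λ p ≡ p
*Λ-identityˡ p = ≡.trans (List.++-identityʳ _) (unit p)
  where
  unit : ∀ p → map ((+ 1 , (+ 0 , + 0)) ·ₘ_) p ≡ p
  unit []            = refl
  unit ((d , e) ∷ p) = cong₂ _∷_
    (cong₂ _,_ (ℤ.*-identityˡ d) (cong₂ _,_ (ℤ.+-identityˡ _) (ℤ.+-identityˡ _))) (unit p)

*Λ-identityʳ : ∀ p → p *Λ 1Λ ≡ p
*Λ-identityʳ []            = refl
*Λ-identityʳ ((c , e) ∷ p) = cong₂ _∷_
  (cong₂ _,_ (ℤ.*-identityʳ c) (cong₂ _,_ (ℤ.+-identityʳ _) (ℤ.+-identityʳ _))) (*Λ-identityʳ p)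

ℤΛ : Ring _ _
ℤΛ = record
  { Carrier = ZΛ ; _≈_ = _≋_ ; _+_ = _+Λ_ ; _*_ = _*Λ_ ; -_ = -Λ_ ; 0# = 0Λ ; 1# = 1Λ
  ; isRing = record
    { +-isAbelianGroup = AbelianGroup.isAbelianGroup ℤΛ-+-abelianGroup
    ; *-cong = λ {p} {p′} {q} {q′} p≋p′ q≋q′ → ≋-trans (*Λ-congˡ q p≋p′) (*Λ-congʳ p′ q≋q′)
    ; *-assoc = λ p q r → ≡⇒≋ (*Λ-assoc p q r)
    ; *-identity = (λ p → ≡⇒≋ (*Λ-identityˡ p)) , (λ p → ≡⇒≋ (*Λ-identityʳ p))
    ; distrib = *Λ-distribˡ , (λ r p q → ≡⇒≋ (*Λ-distribʳ p q r)) } }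

-- Deciding closed identities in ℤ[Λ]

_≤E_ : Exp → Exp → Bool
(a , b) ≤E (c , d) = if ⌊ a ≟ c ⌋ then b ≤ᵇ d else a ≤ᵇ c

insert : ℤ × Exp → ZΛ → ZΛ
insert t             []             = t ∷ []
insert (c , e) ((d , e′) ∷ p) =
  if e ≟E e′ then (c +ℤ d , e′) ∷ p
  else if e ≤E e′ then (c , e) ∷ (d , e′) ∷ p
  else (d , e′) ∷ insert (c , e) p

dropZeros : ZΛ → ZΛ
dropZeros []            = []
dropZeros ((c , e) ∷ p) = if ⌊ c ≟ + 0 ⌋ then dropZeros p else (c , e) ∷ dropZeros p

normalise : ZΛ → ZΛ
normalise p = dropZeros (foldr insert [] p)

coeff-insert : ∀ t p m → coeff (insert t p) m ≡ coeff (t ∷ p) m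
coeff-insert t              []             m = refl
coeff-insert (c , e) ((d , e′) ∷ p) m with e ≟E e′ in e≟e′
... | true with refl ← ≟E-sound {e} {e′} e≟e′ with e ≟E m
...   | true  = ℤ.+-assoc c d (coeff p m)
...   | false = ≡.sym (ℤ.+-identityˡ (+ 0 +ℤ coeff p m))
coeff-insert (c , e) ((d , e′) ∷ p) m | false with e ≤E e′
...   | true  = refl
...   | false = ≡.trans (cong (_+ℤ_ (if e′ ≟E m then d else + 0)) (coeff-insert (c , e) p m))
                        (x+[y+z]≡y+[x+z] (if e′ ≟E m then d else + 0) (if e ≟E m then c else + 0) (coeff p m))
  where x+[y+z]≡y+[x+z] : ∀ x y z → x +ℤ (y +ℤ z) ≡ y +ℤ (x +ℤ z)
        x+[y+z]≡y+[x+z] = solve-∀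

coeff-dropZeros : ∀ p m → coeff (dropZeros p) m ≡ coeff p m
coeff-dropZeros []            m = refl
coeff-dropZeros ((c , e) ∷ p) m with c ≟ + 0
... | no _     = cong (_+ℤ_ (if e ≟E m then c else + 0)) (coeff-dropZeros p m)
... | yes refl with e ≟E m
...   | true  = ≡.trans (coeff-dropZeros p m) (≡.sym (ℤ.+-identityˡ _))
...   | false = ≡.trans (coeff-dropZeros p m) (≡.sym (ℤ.+-identityˡ _))

coeff-normalise : ∀ p m → coeff (normalise p) m ≡ coeff p m
coeff-normalise p m = ≡.trans (coeff-dropZeros (foldr insert [] p) m) (sorted p)
  where
  sorted : ∀ p → coeff (foldr insert [] p) m ≡ coeff p m
  sorted []            = refl
  sorted ((c , e) ∷ p) = ≡.trans (coeff-insert (c , e) (foldr insert [] p) m)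
                                 (cong (_+ℤ_ (if e ≟E m then c else + 0)) (sorted p))

≋-by-normalise : ∀ {p q} → normalise p ≡ normalise q → p ≋ q
≋-by-normalise {p} {q} eq = coeffwise λ m →
  ≡.trans (≡.sym (coeff-normalise p m)) (≡.trans (cong (λ r → coeff r m) eq) (coeff-normalise q m))

-- A non-zero-divisor in ℤ[Λ]

trinomial : ZΛ
trinomial = e^ (+ 1) (-ℤ + 1) +Λ 1Λ +Λ e^ (-ℤ + 1) (+ 1)

module _ where
  open import Data.Integer using (_≤_; _<_; -≤+; +≤+; +<+; ∣_∣)

  i≤∣i∣ : ∀ i → i ≤ + ∣ i ∣
  i≤∣i∣ (+ n)    = ℤ.≤-refl
  i≤∣i∣ -[1+ n ] = -≤+

  bound : ZΛ → ℕ
  bound []                  = 0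
  bound ((c , (a , b)) ∷ p) = ∣ a ∣ ℕ.+ bound p

  coeff-beyond-bound : ∀ p a b → + bound p < a → coeff p (a , b) ≡ + 0
  coeff-beyond-bound []                   a b _ = refl
  coeff-beyond-bound ((c , (a′ , b′)) ∷ p) a b p<a with a′ ≟ a
  ... | yes refl = contradiction p<a (ℤ.≤⇒≯ (ℤ.≤-trans (i≤∣i∣ a′) (+≤+ (ℕ.m≤m+n ∣ a′ ∣ (bound p)))))
  ... | no _     = ≡.trans (ℤ.+-identityˡ _)
                     (coeff-beyond-bound p a b (ℤ.≤-<-trans (+≤+ (ℕ.m≤n+m (bound p) ∣ a′ ∣)) p<a))

  coeff-trinomial-*Λ : ∀ q x y → coeff (trinomial *Λ q) (x , y) ≡
    coeff q (x -ℤ + 1 , y +ℤ + 1) +ℤ coeff q (x , y) +ℤ coeff q (x +ℤ + 1 , y -ℤ + 1)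
  coeff-trinomial-*Λ q x y = begin
    coeff (trinomial *Λ q) (x , y)                       ≡⟨ coeff-*Λ trinomial q (x , y) ⟩
    + 1 *ℤ A +ℤ (+ 1 *ℤ coeff q (x -ℤ + 0 , y -ℤ + 0) +ℤ (+ 1 *ℤ C +ℤ + 0))
      ≡⟨ cong (λ m → + 1 *ℤ A +ℤ (+ 1 *ℤ coeff q m +ℤ (+ 1 *ℤ C +ℤ + 0)))
              (cong₂ _,_ (ℤ.+-identityʳ x) (ℤ.+-identityʳ y)) ⟩
    + 1 *ℤ A +ℤ (+ 1 *ℤ coeff q (x , y) +ℤ (+ 1 *ℤ C +ℤ + 0)) ≡⟨ unit-coefficients A _ C ⟩
    A +ℤ coeff q (x , y) +ℤ C                            ∎
    where
    open ≡.≡-Reasoning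
    A C : ℤ
    A = coeff q (x -ℤ + 1 , y +ℤ + 1)
    C = coeff q (x +ℤ + 1 , y -ℤ + 1)
    unit-coefficients : ∀ a b c → + 1 *ℤ a +ℤ (+ 1 *ℤ b +ℤ (+ 1 *ℤ c +ℤ + 0)) ≡ a +ℤ b +ℤ c
    unit-coefficients = solve-∀

  -- The coefficients of q vanish at first coordinates beyond bound q, and the three-term
  -- recurrence given by trinomial *Λ q ≋ 0Λ carries this down one first coordinate at a time.
  trinomial-regular : ∀ q → trinomial *Λ q ≋ 0Λ → q ≋ 0Λ
  trinomial-regular q tq≋0 = coeffwise vanishes
    where
    F : ℤ → ℤ → ℤ
    F x y = coeff q (x , y)

    T : ℤ
    T = + suc (suc (bound q))

    recurrence : ∀ k y → F (T -ℤ + suc (suc k)) y +ℤ F (T -ℤ + suc k) (y -ℤ + 1) +ℤ F (T -ℤ + k) (y -ℤ + 2) ≡ + 0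
    recurrence k y = begin
      F x y +ℤ F x′ y′ +ℤ F (T -ℤ + k) (y -ℤ + 2)
        ≡⟨ cong₂ (λ u v → u +ℤ F x′ y′ +ℤ v) (cong₂ F (shift₁ T (+ k)) (shift₂ y))
                                              (cong₂ F (shift₃ T (+ k)) (shift₄ y)) ⟩
      F (x′ -ℤ + 1) (y′ +ℤ + 1) +ℤ F x′ y′ +ℤ F (x′ +ℤ + 1) (y′ -ℤ + 1) ≡⟨ coeff-trinomial-*Λ q x′ y′ ⟨
      coeff (trinomial *Λ q) (x′ , y′)                                  ≡⟨ same-coeff tq≋0 (x′ , y′) ⟩
      + 0                                                               ∎
      where
      open ≡.≡-Reasoning
      x x′ y′ : ℤ
      x  = T -ℤ + suc (suc k)
      x′ = T -ℤ + suc k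
      y′ = y -ℤ + 1
      shift₁ : ∀ t k → t -ℤ (+ 2 +ℤ k) ≡ t -ℤ (+ 1 +ℤ k) -ℤ + 1
      shift₁ = solve-∀
      shift₂ : ∀ y → y ≡ y -ℤ + 1 +ℤ + 1
      shift₂ = solve-∀
      shift₃ : ∀ t k → t -ℤ k ≡ t -ℤ (+ 1 +ℤ k) +ℤ + 1
      shift₃ = solve-∀
      shift₄ : ∀ y → y -ℤ + 2 ≡ y -ℤ + 1 -ℤ + 1
      shift₄ = solve-∀

    descent : ∀ k y → F (T -ℤ + k) y ≡ + 0
    descent zero          y = ≡.subst (λ x → F x y ≡ + 0) (≡.sym (ℤ.+-identityʳ T))
      (coeff-beyond-bound q T y (+<+ (ℕ.m<n⇒m<1+n (ℕ.n<1+n (bound q)))))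
    descent (suc zero)    y = coeff-beyond-bound q (+ suc (bound q)) y (+<+ (ℕ.n<1+n (bound q)))
    descent (suc (suc k)) y = begin
      F (T -ℤ + suc (suc k)) y                                   ≡⟨ x+0+0≡x _ ⟨
      F (T -ℤ + suc (suc k)) y +ℤ + 0 +ℤ + 0
        ≡⟨ cong₂ (λ u v → F (T -ℤ + suc (suc k)) y +ℤ u +ℤ v) (descent (suc k) (y -ℤ + 1)) (descent k (y -ℤ + 2)) ⟨
      F (T -ℤ + suc (suc k)) y +ℤ F (T -ℤ + suc k) (y -ℤ + 1) +ℤ F (T -ℤ + k) (y -ℤ + 2)
                                                                 ≡⟨ recurrence k y ⟩
      + 0                                                        ∎
      where
      open ≡.≡-Reasoning
      x+0+0≡x : ∀ x → x +ℤ + 0 +ℤ + 0 ≡ x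
      x+0+0≡x = solve-∀

    T-[T-x]≡x : ∀ t x → t -ℤ (t -ℤ x) ≡ x
    T-[T-x]≡x = solve-∀

    vanishes : ∀ m → coeff q m ≡ coeff 0Λ m
    vanishes (x , y) with T -ℤ x in T-x
    ... | + k      = ≡.subst (λ x → F x y ≡ + 0) (≡.trans (cong (_-ℤ_ T) (≡.sym T-x)) (T-[T-x]≡x T x)) (descent k y)
    ... | -[1+ k ] = coeff-beyond-bound q x y (≡.subst (+ bound q <_) T+k+1≡x
                       (+<+ (ℕ.m≤n⇒m≤1+n (s≤s (ℕ.m≤m+n (bound q) (suc k))))))
      where
      T+k+1≡x : T +ℤ + suc k ≡ x
      T+k+1≡x = ≡.trans (cong (_-ℤ_ T) (≡.sym T-x)) (T-[T-x]≡x T x)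

module RowTimesColumn {c ℓ} (R : Ring c ℓ) where

  open Ring R
  open import Relation.Binary.Reasoning.Setoid setoid
  open import Algebra.Properties.CommutativeSemigroup +-commutativeSemigroup using (interchange)

  row-col-assoc : ∀ a b e f g h n m →
    (a * e + b * g) * n + (a * f + b * h) * m ≈ a * (e * n + f * m) + b * (g * n + h * m)
  row-col-assoc a b e f g h n m = begin
    (a * e + b * g) * n + (a * f + b * h) * m
      ≈⟨ +-cong (distribʳ n _ _) (distribʳ m _ _) ⟩
    (a * e * n + b * g * n) + (a * f * m + b * h * m)
      ≈⟨ +-cong (+-cong (*-assoc a e n) (*-assoc b g n)) (+-cong (*-assoc a f m) (*-assoc b h m)) ⟩
    (a * (e * n) + b * (g * n)) + (a * (f * m) + b * (h * m))
      ≈⟨ interchange _ _ _ _ ⟩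
    (a * (e * n) + a * (f * m)) + (b * (g * n) + b * (h * m))
      ≈⟨ +-cong (distribˡ a _ _) (distribˡ b _ _) ⟨
    a * (e * n + f * m) + b * (g * n + h * m) ∎

  row-col-distribˡ : ∀ a b n n′ m m′ → a * (n + n′) + b * (m + m′) ≈ (a * n + b * m) + (a * n′ + b * m′)
  row-col-distribˡ a b n n′ m m′ =
    trans (+-cong (distribˡ a n n′) (distribˡ b m m′)) (interchange _ _ _ _)

  row-col-distribʳ : ∀ a a′ b b′ n m → (a + a′) * n + (b + b′) * m ≈ (a * n + b * m) + (a′ * n + b′ * m)
  row-col-distribʳ a a′ b b′ n m =
    trans (+-cong (distribʳ n a a′) (distribʳ m b b′)) (interchange _ _ _ _)

  row-col-unitˡ : ∀ a b → 1# * a + 0# * b ≈ a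
  row-col-unitˡ a b = trans (+-cong (*-identityˡ a) (zeroˡ b)) (+-identityʳ a)

  row-col-unitʳ : ∀ a b → 0# * a + 1# * b ≈ b
  row-col-unitʳ a b = trans (+-cong (zeroˡ a) (*-identityˡ b)) (+-identityˡ b)

  row-col-unitˡ′ : ∀ a b → a * 1# + b * 0# ≈ a
  row-col-unitˡ′ a b = trans (+-cong (*-identityʳ a) (zeroʳ b)) (+-identityʳ a)

  row-col-unitʳ′ : ∀ a b → a * 0# + b * 1# ≈ b
  row-col-unitʳ′ a b = trans (+-cong (zeroʳ a) (*-identityʳ b)) (+-identityˡ b)

infix 4 _≋M_
_≋M_ : M2 → M2 → Set
M ≋M N = (a₁₁ M ≋ a₁₁ N) × (a₁₂ M ≋ a₁₂ N) × (a₂₁ M ≋ a₂₁ N) × (a₂₂ M ≋ a₂₂ N)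

+M-abelianGroup : AbelianGroup _ _
+M-abelianGroup = record
  { Carrier = M2 ; _≈_ = _≋M_ ; _∙_ = _+M_ ; ε = 0M ; _⁻¹ = -M_
  ; isAbelianGroup = record
    { isGroup = record
      { isMonoid = record
        { isSemigroup = record
          { isMagma = record
            { isEquivalence = record
              { refl  = ≋-refl , ≋-refl , ≋-refl , ≋-refl
              ; sym   = λ (p , q , r , s) → ≋-sym p , ≋-sym q , ≋-sym r , ≋-sym s
              ; trans = λ (p , q , r , s) (p′ , q′ , r′ , s′) →
                          ≋-trans p p′ , ≋-trans q q′ , ≋-trans r r′ , ≋-trans s s′ }
            ; ∙-cong = λ (p , q , r , s) (p′ , q′ , r′ , s′) →
                         +Λ-cong p p′ , +Λ-cong q q′ , +Λ-cong r r′ , +Λ-cong s s′ }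
          ; assoc = λ { (mat a b c d) (mat a′ b′ c′ d′) (mat a″ b″ c″ d″) →
                        +-assoc a a′ a″ , +-assoc b b′ b″ , +-assoc c c′ c″ , +-assoc d d′ d″ } }
        ; identity = (λ { (mat a b c d) → ≋-refl , ≋-refl , ≋-refl , ≋-refl })
                   , (λ { (mat a b c d) → identityʳ a , identityʳ b , identityʳ c , identityʳ d }) }
      ; inverse = (λ { (mat a b c d) → -Λ-inverseˡ a , -Λ-inverseˡ b , -Λ-inverseˡ c , -Λ-inverseˡ d })
                , (λ { (mat a b c d) → -Λ-inverseʳ a , -Λ-inverseʳ b , -Λ-inverseʳ c , -Λ-inverseʳ d })
      ; ⁻¹-cong = λ (p , q , r , s) → -Λ-cong p , -Λ-cong q , -Λ-cong r , -Λ-cong s }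
    ; comm = λ { (mat a b c d) (mat a′ b′ c′ d′) → +Λ-comm a a′ , +Λ-comm b b′ , +Λ-comm c c′ , +Λ-comm d d′ } } }
  where open AbelianGroup ℤΛ-+-abelianGroup using () renaming (assoc to +-assoc; identityʳ to identityʳ)

End : Ring _ _
End = record
  { Carrier = M2 ; _≈_ = _≋M_ ; _+_ = _+M_ ; _*_ = _*M_ ; -_ = -M_ ; 0# = 0M ; 1# = 1M
  ; isRing = record
    { +-isAbelianGroup = AbelianGroup.isAbelianGroup +M-abelianGroup
    ; *-cong = λ (p , q , r , s) (p′ , q′ , r′ , s′) →
        +Λ-cong (*-cong p p′) (*-cong q r′) , +Λ-cong (*-cong p q′) (*-cong q s′) ,
        +Λ-cong (*-cong r p′) (*-cong s r′) , +Λ-cong (*-cong r q′) (*-cong s s′)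
    ; *-assoc = λ { (mat a b c d) (mat e f g h) (mat i j k l) →
        row-col-assoc a b e f g h i k , row-col-assoc a b e f g h j l ,
        row-col-assoc c d e f g h i k , row-col-assoc c d e f g h j l }
    ; *-identity = (λ { (mat a b c d) → row-col-unitˡ a c , row-col-unitˡ b d , row-col-unitʳ a c , row-col-unitʳ b d })
                 , (λ { (mat a b c d) → row-col-unitˡ′ a b , row-col-unitʳ′ a b , row-col-unitˡ′ c d , row-col-unitʳ′ c d })
    ; distrib = (λ { (mat a b c d) (mat e f g h) (mat e′ f′ g′ h′) →
                     row-col-distribˡ a b e e′ g g′ , row-col-distribˡ a b f f′ h h′ ,
                     row-col-distribˡ c d e e′ g g′ , row-col-distribˡ c d f f′ h h′ })
              , (λ { (mat e f g h) (mat a b c d) (mat a′ b′ c′ d′) →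
                     row-col-distribʳ a a′ b b′ e g , row-col-distribʳ a a′ b b′ f h ,
                     row-col-distribʳ c c′ d d′ e g , row-col-distribʳ c c′ d d′ f h }) } }
  where
  open Ring ℤΛ using (*-cong)
  open RowTimesColumn ℤΛ

-- Coordinates over the centre

data Poly : Set where
  0ᵖ 1ᵖ ξ₁ᵖ ξ₂ᵖ ξ₂⁻¹ᵖ : Poly
  _+ᵖ_ _*ᵖ_           : Poly → Poly → Poly
  -ᵖ_                 : Poly → Poly

data Basis : Set where
  β₁ βₛ βᵤ βₛᵤ : Basis

Coords : Set
Coords = Basis → Poly

∑ᵦ : ∀ {a} {A : Set a} → (A → A → A) → (Basis → A) → A
∑ᵦ _∙_ f = ((f β₁ ∙ f βₛ) ∙ f βᵤ) ∙ f βₛᵤ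

coords : Poly → Poly → Poly → Poly → Coords
coords a b c d β₁  = a
coords a b c d βₛ  = b
coords a b c d βᵤ  = c
coords a b c d βₛᵤ = d

single : Basis → Poly → Coords
single β₁  a = coords a 0ᵖ 0ᵖ 0ᵖ
single βₛ  a = coords 0ᵖ a 0ᵖ 0ᵖ
single βᵤ  a = coords 0ᵖ 0ᵖ a 0ᵖ
single βₛᵤ a = coords 0ᵖ 0ᵖ 0ᵖ a

0ᶜ 1ᶜ : Coords
0ᶜ _ = 0ᵖ
1ᶜ   = single β₁ 1ᵖ

infixl 6 _⊞_ _⊟_
infixl 7 _⋆_

_⊞_ : Coords → Coords → Coords
(v ⊞ w) β = v β +ᵖ w β

_⋆_ : Coords → Poly → Coords
(v ⋆ a) β = v β *ᵖ a

_⊟_ : Coords → Coords → Coords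
v ⊟ w = v ⊞ w ⋆ (-ᵖ 1ᵖ)

-- T β are the coordinates of g · β for a fixed g; then T ⊛ v are those of g · v.
_⊛_ : (Basis → Coords) → Coords → Coords
T ⊛ v = ∑ᵦ _⊞_ (λ β → T β ⋆ v β)

-- In ℋ(0): U S = z₁ − U − SU and U SU = − z₂ − S z₂ + U z₁, using S U² = U² S; U⁻¹ = z₂⁻¹ U.
timesS timesU timesU⁻¹ : Basis → Coords
timesS β₁  = single βₛ 1ᵖ
timesS βₛ  = single βₛ (-ᵖ 1ᵖ)
timesS βᵤ  = single βₛᵤ 1ᵖ
timesS βₛᵤ = single βₛᵤ (-ᵖ 1ᵖ)
timesU β₁  = single βᵤ 1ᵖ
timesU βₛ  = coords ξ₁ᵖ 0ᵖ (-ᵖ 1ᵖ) (-ᵖ 1ᵖ)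
timesU βᵤ  = single β₁ ξ₂ᵖ
timesU βₛᵤ = coords (-ᵖ ξ₂ᵖ) (-ᵖ ξ₂ᵖ) ξ₁ᵖ 0ᵖ
timesU⁻¹ β = timesU β ⋆ ξ₂⁻¹ᵖ

act : HTerm → Coords → Coords
act S       v = timesS ⊛ v
act U       v = timesU ⊛ v
act U⁻¹     v = timesU⁻¹ ⊛ v
act 𝟘       v = 0ᶜ
act 𝟙       v = v
act (x ⊕ y) v = act x v ⊞ act y v
act (x ⊗ y) v = act x (act y v)
act (⊖ x)   v = act x v ⋆ (-ᵖ 1ᵖ)

decompose : HTerm → Coords
decompose x = act x 1ᶜ

module PolyEvaluation {c ℓ} (R : Ring c ℓ) (z₁ z₂ z₂⁻¹ : Ring.Carrier R) where

  open Ring R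

  ⟦_⟧ᵖ : Poly → Carrier
  ⟦ 0ᵖ ⟧ᵖ     = 0#
  ⟦ 1ᵖ ⟧ᵖ     = 1#
  ⟦ ξ₁ᵖ ⟧ᵖ    = z₁
  ⟦ ξ₂ᵖ ⟧ᵖ    = z₂
  ⟦ ξ₂⁻¹ᵖ ⟧ᵖ  = z₂⁻¹
  ⟦ a +ᵖ b ⟧ᵖ = ⟦ a ⟧ᵖ + ⟦ b ⟧ᵖ
  ⟦ a *ᵖ b ⟧ᵖ = ⟦ a ⟧ᵖ * ⟦ b ⟧ᵖ
  ⟦ -ᵖ a ⟧ᵖ   = - ⟦ a ⟧ᵖ

module Evaluation {c ℓ} (R : Ring c ℓ) (s u u⁻¹ z₁ z₂ z₂⁻¹ : Ring.Carrier R) where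

  open Ring R renaming (refl to ≈-refl)
  open import Algebra.Properties.Ring R using (-‿distribˡ-*; -‿distribʳ-*)
  open import Algebra.Properties.CommutativeSemigroup +-commutativeSemigroup using (interchange)
  open import Relation.Binary.Reasoning.Setoid setoid
  open PolyEvaluation R z₁ z₂ z₂⁻¹ public

  ⟦_⟧ᵗ : HTerm → Carrier
  ⟦ S ⟧ᵗ     = s
  ⟦ U ⟧ᵗ     = u
  ⟦ U⁻¹ ⟧ᵗ   = u⁻¹
  ⟦ 𝟘 ⟧ᵗ     = 0#
  ⟦ 𝟙 ⟧ᵗ     = 1#
  ⟦ x ⊕ y ⟧ᵗ = ⟦ x ⟧ᵗ + ⟦ y ⟧ᵗ
  ⟦ x ⊗ y ⟧ᵗ = ⟦ x ⟧ᵗ * ⟦ y ⟧ᵗ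
  ⟦ ⊖ x ⟧ᵗ   = - ⟦ x ⟧ᵗ

  basis : Basis → Carrier
  basis β₁  = 1#
  basis βₛ  = s
  basis βᵤ  = u
  basis βₛᵤ = s * u

  lincomb : (Basis → Carrier) → Carrier
  lincomb f = ∑ᵦ _+_ (λ β → basis β * f β)

  ⟦_⟧ᶜ : Coords → Carrier
  ⟦ v ⟧ᶜ = lincomb (λ β → ⟦ v β ⟧ᵖ)

  ∑ᵦ-cong : ∀ f g → (∀ β → f β ≈ g β) → ∑ᵦ _+_ f ≈ ∑ᵦ _+_ g
  ∑ᵦ-cong f g f≈g = +-cong (+-cong (+-cong (f≈g β₁) (f≈g βₛ)) (f≈g βᵤ)) (f≈g βₛᵤ)

  ∑ᵦ-+ : ∀ f g → ∑ᵦ _+_ (λ β → f β + g β) ≈ ∑ᵦ _+_ f + ∑ᵦ _+_ g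
  ∑ᵦ-+ f g = trans (+-congʳ (trans (+-congʳ (interchange (f β₁) (g β₁) (f βₛ) (g βₛ)))
                                   (interchange (f β₁ + f βₛ) (g β₁ + g βₛ) (f βᵤ) (g βᵤ))))
                   (interchange (f β₁ + f βₛ + f βᵤ) (g β₁ + g βₛ + g βᵤ) (f βₛᵤ) (g βₛᵤ))

  *-distribˡ-∑ᵦ : ∀ x f → x * ∑ᵦ _+_ f ≈ ∑ᵦ _+_ (λ β → x * f β)
  *-distribˡ-∑ᵦ x f = trans (distribˡ x _ (f βₛᵤ))
    (+-congʳ (trans (distribˡ x _ (f βᵤ)) (+-congʳ (distribˡ x (f β₁) (f βₛ)))))

  *-distribʳ-∑ᵦ : ∀ x f → ∑ᵦ _+_ f * x ≈ ∑ᵦ _+_ (λ β → f β * x)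
  *-distribʳ-∑ᵦ x f = trans (distribʳ x _ (f βₛᵤ))
    (+-congʳ (trans (distribʳ x _ (f βᵤ)) (+-congʳ (distribʳ x (f β₁) (f βₛ)))))

  lincomb-cong : ∀ f g → (∀ β → f β ≈ g β) → lincomb f ≈ lincomb g
  lincomb-cong f g f≈g = ∑ᵦ-cong (λ β → basis β * f β) (λ β → basis β * g β) λ β → *-congˡ (f≈g β)

  lincomb-zero : lincomb (λ _ → 0#) ≈ 0#
  lincomb-zero = trans (∑ᵦ-cong _ (λ _ → 0#) λ β → zeroʳ (basis β))
                       (trans (+-identityʳ _) (trans (+-identityʳ _) (+-identityʳ 0#)))

  ⟦⊞⟧ : ∀ v w → ⟦ v ⊞ w ⟧ᶜ ≈ ⟦ v ⟧ᶜ + ⟦ w ⟧ᶜ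
  ⟦⊞⟧ v w = trans (∑ᵦ-cong _ (λ β → basis β * ⟦ v β ⟧ᵖ + basis β * ⟦ w β ⟧ᵖ) λ β → distribˡ (basis β) _ _)
                  (∑ᵦ-+ (λ β → basis β * ⟦ v β ⟧ᵖ) (λ β → basis β * ⟦ w β ⟧ᵖ))

  ⟦⋆⟧ : ∀ v a → ⟦ v ⋆ a ⟧ᶜ ≈ ⟦ v ⟧ᶜ * ⟦ a ⟧ᵖ
  ⟦⋆⟧ v a = trans (∑ᵦ-cong _ (λ β → basis β * ⟦ v β ⟧ᵖ * ⟦ a ⟧ᵖ) λ β → sym (*-assoc (basis β) _ _))
                  (sym (*-distribʳ-∑ᵦ ⟦ a ⟧ᵖ (λ β → basis β * ⟦ v β ⟧ᵖ)))

  ⟦∑⊞⟧ : ∀ F → ⟦ ∑ᵦ _⊞_ F ⟧ᶜ ≈ ∑ᵦ _+_ (λ β → ⟦ F β ⟧ᶜ)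
  ⟦∑⊞⟧ F = trans (⟦⊞⟧ (F β₁ ⊞ F βₛ ⊞ F βᵤ) (F βₛᵤ))
                 (+-congʳ (trans (⟦⊞⟧ (F β₁ ⊞ F βₛ) (F βᵤ)) (+-congʳ (⟦⊞⟧ (F β₁) (F βₛ)))))

  ⟦-1⟧ : ∀ x → x * ⟦ -ᵖ 1ᵖ ⟧ᵖ ≈ - x
  ⟦-1⟧ x = trans (sym (-‿distribʳ-* x 1#)) (-‿cong (*-identityʳ x))

  ⟦⊟⟧ : ∀ v w → ⟦ v ⊟ w ⟧ᶜ ≈ ⟦ v ⟧ᶜ - ⟦ w ⟧ᶜ
  ⟦⊟⟧ v w = trans (⟦⊞⟧ v (w ⋆ (-ᵖ 1ᵖ))) (+-congˡ (trans (⟦⋆⟧ w (-ᵖ 1ᵖ)) (⟦-1⟧ ⟦ w ⟧ᶜ)))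

  ⟦single⟧ : ∀ β a → ⟦ single β a ⟧ᶜ ≈ basis β * ⟦ a ⟧ᵖ
  ⟦single⟧ β₁  a = trans (+-cong (+-cong (+-congˡ (zeroʳ s)) (zeroʳ u)) (zeroʳ (s * u)))
                         (trans (+-identityʳ _) (trans (+-identityʳ _) (+-identityʳ _)))
  ⟦single⟧ βₛ  a = trans (+-cong (+-cong (+-congʳ (zeroʳ 1#)) (zeroʳ u)) (zeroʳ (s * u)))
                         (trans (+-identityʳ _) (trans (+-identityʳ _) (+-identityˡ _)))
  ⟦single⟧ βᵤ  a = trans (+-cong (+-congʳ (+-cong (zeroʳ 1#) (zeroʳ s))) (zeroʳ (s * u)))
                         (trans (+-identityʳ _) (trans (+-congʳ (+-identityʳ 0#)) (+-identityˡ _)))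
  ⟦single⟧ βₛᵤ a = trans (+-congʳ (+-cong (+-cong (zeroʳ 1#) (zeroʳ s)) (zeroʳ u)))
                         (trans (+-congʳ (trans (+-identityʳ _) (+-identityʳ 0#))) (+-identityˡ _))

  ⊛-correct : ∀ g T → (∀ β → g * basis β ≈ ⟦ T β ⟧ᶜ) → ∀ v → g * ⟦ v ⟧ᶜ ≈ ⟦ T ⊛ v ⟧ᶜ
  ⊛-correct g T table v = begin
    g * ⟦ v ⟧ᶜ                                 ≈⟨ *-distribˡ-∑ᵦ g gv ⟩
    ∑ᵦ _+_ (λ β → g * gv β)                    ≈⟨ ∑ᵦ-cong _ Tv (λ β → sym (*-assoc g _ _)) ⟩
    ∑ᵦ _+_ Tv                                  ≈⟨ ∑ᵦ-cong Tv _ (λ β → *-congʳ (table β)) ⟩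
    ∑ᵦ _+_ (λ β → ⟦ T β ⟧ᶜ * ⟦ v β ⟧ᵖ)         ≈⟨ ∑ᵦ-cong _ (λ β → ⟦ T β ⋆ v β ⟧ᶜ) (λ β → sym (⟦⋆⟧ (T β) (v β))) ⟩
    ∑ᵦ _+_ (λ β → ⟦ T β ⋆ v β ⟧ᶜ)              ≈⟨ ⟦∑⊞⟧ (λ β → T β ⋆ v β) ⟨
    ⟦ T ⊛ v ⟧ᶜ                                 ∎
    where
    gv Tv : Basis → Carrier
    gv β = basis β * ⟦ v β ⟧ᵖ
    Tv β = g * basis β * ⟦ v β ⟧ᵖ

  module _ (S-table   : ∀ β → s * basis β ≈ ⟦ timesS β ⟧ᶜ)
           (U-table   : ∀ β → u * basis β ≈ ⟦ timesU β ⟧ᶜ)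
           (U⁻¹-table : ∀ β → u⁻¹ * basis β ≈ ⟦ timesU⁻¹ β ⟧ᶜ) where

    act-correct : ∀ x v → ⟦ x ⟧ᵗ * ⟦ v ⟧ᶜ ≈ ⟦ act x v ⟧ᶜ
    act-correct S       = ⊛-correct s timesS S-table
    act-correct U       = ⊛-correct u timesU U-table
    act-correct U⁻¹     = ⊛-correct u⁻¹ timesU⁻¹ U⁻¹-table
    act-correct 𝟘       v = trans (zeroˡ _) (sym lincomb-zero)
    act-correct 𝟙       v = *-identityˡ _
    act-correct (x ⊕ y) v = begin
      (⟦ x ⟧ᵗ + ⟦ y ⟧ᵗ) * ⟦ v ⟧ᶜ             ≈⟨ distribʳ _ _ _ ⟩
      ⟦ x ⟧ᵗ * ⟦ v ⟧ᶜ + ⟦ y ⟧ᵗ * ⟦ v ⟧ᶜ      ≈⟨ +-cong (act-correct x v) (act-correct y v) ⟩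
      ⟦ act x v ⟧ᶜ + ⟦ act y v ⟧ᶜ            ≈⟨ ⟦⊞⟧ (act x v) (act y v) ⟨
      ⟦ act x v ⊞ act y v ⟧ᶜ                 ∎
    act-correct (x ⊗ y) v = begin
      ⟦ x ⟧ᵗ * ⟦ y ⟧ᵗ * ⟦ v ⟧ᶜ     ≈⟨ *-assoc _ _ _ ⟩
      ⟦ x ⟧ᵗ * (⟦ y ⟧ᵗ * ⟦ v ⟧ᶜ)   ≈⟨ *-congˡ (act-correct y v) ⟩
      ⟦ x ⟧ᵗ * ⟦ act y v ⟧ᶜ        ≈⟨ act-correct x (act y v) ⟩
      ⟦ act x (act y v) ⟧ᶜ         ∎
    act-correct (⊖ x)   v = begin
      - ⟦ x ⟧ᵗ * ⟦ v ⟧ᶜ             ≈⟨ -‿distribˡ-* _ _ ⟨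
      - (⟦ x ⟧ᵗ * ⟦ v ⟧ᶜ)           ≈⟨ -‿cong (act-correct x v) ⟩
      - ⟦ act x v ⟧ᶜ                ≈⟨ ⟦-1⟧ _ ⟨
      ⟦ act x v ⟧ᶜ * ⟦ -ᵖ 1ᵖ ⟧ᵖ     ≈⟨ ⟦⋆⟧ (act x v) (-ᵖ 1ᵖ) ⟨
      ⟦ act x v ⋆ (-ᵖ 1ᵖ) ⟧ᶜ        ∎

    decompose-correct : ∀ x → ⟦ x ⟧ᵗ ≈ ⟦ decompose x ⟧ᶜ
    decompose-correct x = begin
      ⟦ x ⟧ᵗ              ≈⟨ *-identityʳ _ ⟨
      ⟦ x ⟧ᵗ * 1#         ≈⟨ *-congˡ (trans (⟦single⟧ β₁ 1ᵖ) (*-identityˡ 1#)) ⟨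
      ⟦ x ⟧ᵗ * ⟦ 1ᶜ ⟧ᶜ    ≈⟨ act-correct x 1ᶜ ⟩
      ⟦ decompose x ⟧ᶜ    ∎

ℋ : Ring _ _
ℋ = record
  { Carrier = HTerm ; _≈_ = _∼_ ; _+_ = _⊕_ ; _*_ = _⊗_ ; -_ = ⊖_ ; 0# = 𝟘 ; 1# = 𝟙
  ; isRing = record
    { +-isAbelianGroup = record
      { isGroup = record
        { isMonoid = record
          { isSemigroup = record
            { isMagma = record
              { isEquivalence = record { refl = ∼-refl ; sym = ∼-sym ; trans = ∼-trans }
              ; ∙-cong = ⊕-cong }
            ; assoc = ⊕-assoc }
          ; identity = ⊕-identityˡ , λ x → ∼-trans (⊕-comm x 𝟘) (⊕-identityˡ x) }
        ; inverse = ⊖-inverseˡ , λ x → ∼-trans (⊕-comm x (⊖ x)) (⊖-inverseˡ x)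
        ; ⁻¹-cong = ⊖-cong }
      ; comm = ⊕-comm }
    ; *-cong = ⊗-cong
    ; *-assoc = ⊗-assoc
    ; *-identity = ⊗-identityˡ , ⊗-identityʳ
    ; distrib = _∼_.distribˡ , _∼_.distribʳ } }

module ℋ-Properties where
  open Ring ℋ public using (reflexive; +-identityʳ; -‿inverseʳ; zeroˡ; zeroʳ; distribˡ; distribʳ; +-congˡ; +-congʳ; *-congˡ; *-congʳ)
  open import Algebra.Properties.Ring ℋ public using (-‿distribˡ-*; -‿distribʳ-*)
  open import Algebra.Properties.AbelianGroup (Ring.+-abelianGroup ℋ) public
    using (//-rightDividesˡ; //-rightDividesʳ; ⁻¹-∙-comm; ε⁻¹≈ε; x∙y⁻¹≈ε⇒x≈y)
  open import Algebra.Properties.CommutativeSemigroup (Ring.+-commutativeSemigroup ℋ) public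
    using (interchange; xy∙z≈zy∙x; xy∙z≈xz∙y)
  open import Relation.Binary.Reasoning.Setoid (Ring.setoid ℋ) public

module _ where

  open ℋ-Properties

  Central : HTerm → Set
  Central c = ∀ x → c ⊗ x ∼ x ⊗ c

  inverse-central : ∀ {c c⁻¹} → c ⊗ c⁻¹ ∼ 𝟙 → c⁻¹ ⊗ c ∼ 𝟙 → ∀ x → c ⊗ x ∼ x ⊗ c → c⁻¹ ⊗ x ∼ x ⊗ c⁻¹
  inverse-central {c} {c⁻¹} cc⁻¹ c⁻¹c x cx∼xc = begin
    c⁻¹ ⊗ x                    ≈⟨ ⊗-identityʳ _ ⟨
    c⁻¹ ⊗ x ⊗ 𝟙                ≈⟨ *-congˡ cc⁻¹ ⟨
    c⁻¹ ⊗ x ⊗ (c ⊗ c⁻¹)        ≈⟨ ⊗-assoc _ _ _ ⟩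
    c⁻¹ ⊗ (x ⊗ (c ⊗ c⁻¹))      ≈⟨ *-congˡ (⊗-assoc x c c⁻¹) ⟨
    c⁻¹ ⊗ (x ⊗ c ⊗ c⁻¹)        ≈⟨ *-congˡ (*-congʳ cx∼xc) ⟨
    c⁻¹ ⊗ (c ⊗ x ⊗ c⁻¹)        ≈⟨ *-congˡ (⊗-assoc c x c⁻¹) ⟩
    c⁻¹ ⊗ (c ⊗ (x ⊗ c⁻¹))      ≈⟨ ⊗-assoc _ _ _ ⟨
    c⁻¹ ⊗ c ⊗ (x ⊗ c⁻¹)        ≈⟨ *-congʳ c⁻¹c ⟩
    𝟙 ⊗ (x ⊗ c⁻¹)              ≈⟨ ⊗-identityˡ _ ⟩
    x ⊗ c⁻¹                    ∎

  central : ∀ c → c ⊗ S ∼ S ⊗ c → c ⊗ U ∼ U ⊗ c → Central c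
  central c cS∼Sc cU∼Uc S       = cS∼Sc
  central c cS∼Sc cU∼Uc U       = cU∼Uc
  central c cS∼Sc cU∼Uc U⁻¹     = ∼-sym (inverse-central rel-UU⁻¹ rel-U⁻¹U c (∼-sym cU∼Uc))
  central c cS∼Sc cU∼Uc 𝟘       = ∼-trans (zeroʳ c) (∼-sym (zeroˡ c))
  central c cS∼Sc cU∼Uc 𝟙       = ∼-trans (⊗-identityʳ c) (∼-sym (⊗-identityˡ c))
  central c cS∼Sc cU∼Uc (x ⊕ y) = begin
    c ⊗ (x ⊕ y)          ≈⟨ distribˡ c x y ⟩
    c ⊗ x ⊕ c ⊗ y        ≈⟨ ⊕-cong (central c cS∼Sc cU∼Uc x) (central c cS∼Sc cU∼Uc y) ⟩
    x ⊗ c ⊕ y ⊗ c        ≈⟨ distribʳ c x y ⟨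
    (x ⊕ y) ⊗ c          ∎
  central c cS∼Sc cU∼Uc (x ⊗ y) = begin
    c ⊗ (x ⊗ y)          ≈⟨ ⊗-assoc c x y ⟨
    c ⊗ x ⊗ y            ≈⟨ *-congʳ (central c cS∼Sc cU∼Uc x) ⟩
    x ⊗ c ⊗ y            ≈⟨ ⊗-assoc x c y ⟩
    x ⊗ (c ⊗ y)          ≈⟨ *-congˡ (central c cS∼Sc cU∼Uc y) ⟩
    x ⊗ (y ⊗ c)          ≈⟨ ⊗-assoc x y c ⟨
    x ⊗ y ⊗ c            ∎
  central c cS∼Sc cU∼Uc (⊖ x)   = begin
    c ⊗ ⊖ x              ≈⟨ -‿distribʳ-* c x ⟨
    ⊖ (c ⊗ x)            ≈⟨ ⊖-cong (central c cS∼Sc cU∼Uc x) ⟩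
    ⊖ (x ⊗ c)            ≈⟨ -‿distribˡ-* x c ⟩
    ⊖ x ⊗ c              ∎

  z₁ z₂ z₂⁻¹ : HTerm
  z₁   = U ⊗ S ⊕ U ⊕ S ⊗ U
  z₂   = U ⊗ U
  z₂⁻¹ = U⁻¹ ⊗ U⁻¹

  z₂z₂⁻¹∼𝟙 : z₂ ⊗ z₂⁻¹ ∼ 𝟙
  z₂z₂⁻¹∼𝟙 = begin
    U ⊗ U ⊗ (U⁻¹ ⊗ U⁻¹)     ≈⟨ ⊗-assoc _ _ _ ⟩
    U ⊗ (U ⊗ (U⁻¹ ⊗ U⁻¹))   ≈⟨ *-congˡ (⊗-assoc U U⁻¹ U⁻¹) ⟨
    U ⊗ (U ⊗ U⁻¹ ⊗ U⁻¹)     ≈⟨ *-congˡ (*-congʳ rel-UU⁻¹) ⟩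
    U ⊗ (𝟙 ⊗ U⁻¹)           ≈⟨ *-congˡ (⊗-identityˡ U⁻¹) ⟩
    U ⊗ U⁻¹                 ≈⟨ rel-UU⁻¹ ⟩
    𝟙                       ∎

  z₂⁻¹z₂∼𝟙 : z₂⁻¹ ⊗ z₂ ∼ 𝟙
  z₂⁻¹z₂∼𝟙 = begin
    U⁻¹ ⊗ U⁻¹ ⊗ (U ⊗ U)     ≈⟨ ⊗-assoc _ _ _ ⟩
    U⁻¹ ⊗ (U⁻¹ ⊗ (U ⊗ U))   ≈⟨ *-congˡ (⊗-assoc U⁻¹ U U) ⟨
    U⁻¹ ⊗ (U⁻¹ ⊗ U ⊗ U)     ≈⟨ *-congˡ (*-congʳ rel-U⁻¹U) ⟩
    U⁻¹ ⊗ (𝟙 ⊗ U)           ≈⟨ *-congˡ (⊗-identityˡ U) ⟩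
    U⁻¹ ⊗ U                 ≈⟨ rel-U⁻¹U ⟩
    𝟙                       ∎

  z₂-central : Central z₂
  z₂-central = central z₂ rel-UUS (⊗-assoc U U U)

  z₂⁻¹-central : Central z₂⁻¹
  z₂⁻¹-central x = inverse-central z₂z₂⁻¹∼𝟙 z₂⁻¹z₂∼𝟙 x (z₂-central x)

  S⊗S⊗x∼⊖S⊗x : ∀ x → S ⊗ (S ⊗ x) ∼ ⊖ (S ⊗ x)
  S⊗S⊗x∼⊖S⊗x x = begin
    S ⊗ (S ⊗ x)   ≈⟨ ⊗-assoc S S x ⟨
    S ⊗ S ⊗ x     ≈⟨ *-congʳ rel-SS ⟩
    ⊖ S ⊗ x       ≈⟨ -‿distribˡ-* S x ⟨
    ⊖ (S ⊗ x)     ∎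

  z₁-central : Central z₁
  z₁-central = central z₁ z₁S∼Sz₁ z₁U∼Uz₁
    where
    z₁S∼Sz₁ : z₁ ⊗ S ∼ S ⊗ z₁
    z₁S∼Sz₁ = begin
      (U ⊗ S ⊕ U ⊕ S ⊗ U) ⊗ S                  ≈⟨ ∼-trans (distribʳ S _ _) (+-congʳ (distribʳ S _ _)) ⟩
      U ⊗ S ⊗ S ⊕ U ⊗ S ⊕ S ⊗ U ⊗ S            ≈⟨ +-congʳ (+-congʳ (∼-trans (⊗-assoc U S S) (US⊗S∼⊖US))) ⟩
      ⊖ (U ⊗ S) ⊕ U ⊗ S ⊕ S ⊗ U ⊗ S            ≈⟨ ∼-trans (+-congʳ (⊖-inverseˡ _)) (⊕-identityˡ _) ⟩
      S ⊗ U ⊗ S                                ≈⟨ //-rightDividesʳ (S ⊗ U) _ ⟨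
      S ⊗ U ⊗ S ⊕ S ⊗ U ⊕ ⊖ (S ⊗ U)            ≈⟨ ⊕-cong (+-congʳ (∼-sym (⊗-assoc S U S))) (S⊗S⊗x∼⊖S⊗x U) ⟨
      S ⊗ (U ⊗ S) ⊕ S ⊗ U ⊕ S ⊗ (S ⊗ U)        ≈⟨ ∼-trans (distribˡ S _ _) (+-congʳ (distribˡ S _ _)) ⟨
      S ⊗ (U ⊗ S ⊕ U ⊕ S ⊗ U)                  ∎
      where
      US⊗S∼⊖US : U ⊗ (S ⊗ S) ∼ ⊖ (U ⊗ S)
      US⊗S∼⊖US = ∼-trans (*-congˡ rel-SS) (∼-sym (-‿distribʳ-* U S))
    z₁U∼Uz₁ : z₁ ⊗ U ∼ U ⊗ z₁
    z₁U∼Uz₁ = begin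
      (U ⊗ S ⊕ U ⊕ S ⊗ U) ⊗ U                  ≈⟨ ∼-trans (distribʳ U _ _) (+-congʳ (distribʳ U _ _)) ⟩
      U ⊗ S ⊗ U ⊕ U ⊗ U ⊕ S ⊗ U ⊗ U            ≈⟨ ⊕-cong (+-congʳ (⊗-assoc U S U)) SUU∼UUS ⟩
      U ⊗ (S ⊗ U) ⊕ U ⊗ U ⊕ U ⊗ (U ⊗ S)        ≈⟨ xy∙z≈zy∙x _ _ _ ⟩
      U ⊗ (U ⊗ S) ⊕ U ⊗ U ⊕ U ⊗ (S ⊗ U)        ≈⟨ ∼-trans (distribˡ U _ _) (+-congʳ (distribˡ U _ _)) ⟨
      U ⊗ (U ⊗ S ⊕ U ⊕ S ⊗ U)                  ∎
      where
      SUU∼UUS : S ⊗ U ⊗ U ∼ U ⊗ (U ⊗ S)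
      SUU∼UUS = ∼-trans (⊗-assoc S U U) (∼-trans (∼-sym rel-UUS) (⊗-assoc U U S))

module ℋ-Eval = Evaluation ℋ S U U⁻¹ z₁ z₂ z₂⁻¹
open ℋ-Eval using () renaming (⟦_⟧ᵖ to ⟦_⟧ᵖᴴ; ⟦_⟧ᶜ to ⟦_⟧ᴴ)

module _ where

  open ℋ-Properties
  open ℋ-Eval using (basis; ⟦single⟧; ⟦-1⟧; ⟦⋆⟧)

  S-tableᴴ : ∀ β → S ⊗ basis β ∼ ⟦ timesS β ⟧ᴴ
  S-tableᴴ β₁  = ∼-sym (⟦single⟧ βₛ 1ᵖ)
  S-tableᴴ βₛ  = ∼-trans rel-SS (∼-sym (∼-trans (⟦single⟧ βₛ (-ᵖ 1ᵖ)) (⟦-1⟧ S)))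
  S-tableᴴ βᵤ  = ∼-sym (∼-trans (⟦single⟧ βₛᵤ 1ᵖ) (⊗-identityʳ (S ⊗ U)))
  S-tableᴴ βₛᵤ = ∼-trans (S⊗S⊗x∼⊖S⊗x U) (∼-sym (∼-trans (⟦single⟧ βₛᵤ (-ᵖ 1ᵖ)) (⟦-1⟧ (S ⊗ U))))

  U-tableᴴ : ∀ β → U ⊗ basis β ∼ ⟦ timesU β ⟧ᴴ
  U-tableᴴ β₁  = ∼-sym (⟦single⟧ βᵤ 1ᵖ)
  U-tableᴴ βₛ  = ∼-sym (begin
    𝟙 ⊗ z₁ ⊕ S ⊗ 𝟘 ⊕ U ⊗ ⊖ 𝟙 ⊕ S ⊗ U ⊗ ⊖ 𝟙
      ≈⟨ ⊕-cong (⊕-cong (⊕-cong (⊗-identityˡ z₁) (zeroʳ S)) (⟦-1⟧ U)) (⟦-1⟧ (S ⊗ U)) ⟩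
    z₁ ⊕ 𝟘 ⊕ ⊖ U ⊕ ⊖ (S ⊗ U)                       ≈⟨ +-congʳ (+-congʳ (+-identityʳ z₁)) ⟩
    U ⊗ S ⊕ U ⊕ S ⊗ U ⊕ ⊖ U ⊕ ⊖ (S ⊗ U)            ≈⟨ +-congʳ (+-congʳ (xy∙z≈xz∙y (U ⊗ S) U (S ⊗ U))) ⟩
    U ⊗ S ⊕ S ⊗ U ⊕ U ⊕ ⊖ U ⊕ ⊖ (S ⊗ U)            ≈⟨ +-congʳ (//-rightDividesʳ U (U ⊗ S ⊕ S ⊗ U)) ⟩
    U ⊗ S ⊕ S ⊗ U ⊕ ⊖ (S ⊗ U)                      ≈⟨ //-rightDividesʳ (S ⊗ U) (U ⊗ S) ⟩
    U ⊗ S                                          ∎)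
  U-tableᴴ βᵤ  = ∼-sym (∼-trans (⟦single⟧ β₁ ξ₂ᵖ) (⊗-identityˡ z₂))
  U-tableᴴ βₛᵤ = ∼-sym (begin
    𝟙 ⊗ ⊖ z₂ ⊕ S ⊗ ⊖ z₂ ⊕ U ⊗ z₁ ⊕ S ⊗ U ⊗ 𝟘
      ≈⟨ ∼-trans (+-congʳ (+-congʳ (⊕-cong (⊗-identityˡ _) (∼-sym (-‿distribʳ-* S z₂))))) (⊕-cong ∼-refl (zeroʳ _)) ⟩
    ⊖ z₂ ⊕ ⊖ (S ⊗ z₂) ⊕ U ⊗ z₁ ⊕ 𝟘                 ≈⟨ +-identityʳ _ ⟩
    ⊖ z₂ ⊕ ⊖ (S ⊗ z₂) ⊕ U ⊗ (U ⊗ S ⊕ U ⊕ S ⊗ U)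
      ≈⟨ ⊕-cong (+-congˡ (⊖-cong Sz₂∼UUS)) (∼-trans (distribˡ U _ _) (+-congʳ (distribˡ U _ _))) ⟩
    ⊖ z₂ ⊕ ⊖ UUS ⊕ (UUS ⊕ z₂ ⊕ U ⊗ (S ⊗ U))        ≈⟨ ⊕-assoc _ _ _ ⟨
    ⊖ z₂ ⊕ ⊖ UUS ⊕ (UUS ⊕ z₂) ⊕ U ⊗ (S ⊗ U)        ≈⟨ +-congʳ (⊕-cong (⁻¹-∙-comm z₂ UUS) (⊕-comm UUS z₂)) ⟩
    ⊖ (z₂ ⊕ UUS) ⊕ (z₂ ⊕ UUS) ⊕ U ⊗ (S ⊗ U)        ≈⟨ ∼-trans (+-congʳ (⊖-inverseˡ _)) (⊕-identityˡ _) ⟩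
    U ⊗ (S ⊗ U)                                    ∎)
    where
    UUS : HTerm
    UUS = U ⊗ (U ⊗ S)
    Sz₂∼UUS : S ⊗ z₂ ∼ UUS
    Sz₂∼UUS = ∼-trans (∼-sym (z₂-central S)) (⊗-assoc U U S)

  U⁻¹-tableᴴ : ∀ β → U⁻¹ ⊗ basis β ∼ ⟦ timesU⁻¹ β ⟧ᴴ
  U⁻¹-tableᴴ β = begin
    U⁻¹ ⊗ basis β                ≈⟨ *-congʳ U⁻¹∼z₂⁻¹U ⟩
    z₂⁻¹ ⊗ U ⊗ basis β           ≈⟨ ⊗-assoc _ _ _ ⟩
    z₂⁻¹ ⊗ (U ⊗ basis β)         ≈⟨ z₂⁻¹-central _ ⟩
    U ⊗ basis β ⊗ z₂⁻¹           ≈⟨ *-congʳ (U-tableᴴ β) ⟩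
    ⟦ timesU β ⟧ᴴ ⊗ z₂⁻¹         ≈⟨ ⟦⋆⟧ (timesU β) ξ₂⁻¹ᵖ ⟨
    ⟦ timesU⁻¹ β ⟧ᴴ              ∎
    where
    U⁻¹∼z₂⁻¹U : U⁻¹ ∼ z₂⁻¹ ⊗ U
    U⁻¹∼z₂⁻¹U = ∼-sym (∼-trans (⊗-assoc _ _ _) (∼-trans (*-congˡ rel-U⁻¹U) (⊗-identityʳ U⁻¹)))

  ⟦⟧ᵗ-ℋ : ∀ x → ℋ-Eval.⟦ x ⟧ᵗ ≡ x
  ⟦⟧ᵗ-ℋ S       = refl
  ⟦⟧ᵗ-ℋ U       = refl
  ⟦⟧ᵗ-ℋ U⁻¹     = refl
  ⟦⟧ᵗ-ℋ 𝟘       = refl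
  ⟦⟧ᵗ-ℋ 𝟙       = refl
  ⟦⟧ᵗ-ℋ (x ⊕ y) = cong₂ _⊕_ (⟦⟧ᵗ-ℋ x) (⟦⟧ᵗ-ℋ y)
  ⟦⟧ᵗ-ℋ (x ⊗ y) = cong₂ _⊗_ (⟦⟧ᵗ-ℋ x) (⟦⟧ᵗ-ℋ y)
  ⟦⟧ᵗ-ℋ (⊖ x)   = cong ⊖_ (⟦⟧ᵗ-ℋ x)

  decompose-correctᴴ : ∀ x → x ∼ ⟦ decompose x ⟧ᴴ
  decompose-correctᴴ x = ≡.subst (_∼ ⟦ decompose x ⟧ᴴ) (⟦⟧ᵗ-ℋ x)
    (ℋ-Eval.decompose-correct S-tableᴴ U-tableᴴ U⁻¹-tableᴴ x)

ξ₂⁻¹ : ZΛ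
ξ₂⁻¹ = e^ (-ℤ + 1) (-ℤ + 1)

diag : ZΛ → M2
diag p = mat p 0Λ 0Λ p

module End-Eval = Evaluation End minusDs AU AUinv (diag ξ₁) (diag ξ₂) (diag ξ₂⁻¹)
open End-Eval using () renaming (⟦_⟧ᶜ to ⟦_⟧ᴱ; basis to basisᴱ)

normaliseM : M2 → M2
normaliseM (mat a b c d) = mat (normalise a) (normalise b) (normalise c) (normalise d)

≋M-by-normalise : ∀ {M N} → normaliseM M ≡ normaliseM N → M ≋M N
≋M-by-normalise {mat a b c d} {mat a′ b′ c′ d′} eq =
  ≋-by-normalise (cong a₁₁ eq) , ≋-by-normalise (cong a₁₂ eq) ,
  ≋-by-normalise (cong a₂₁ eq) , ≋-by-normalise (cong a₂₂ eq)

S-tableᴱ : ∀ β → minusDs *M basisᴱ β ≋M ⟦ timesS β ⟧ᴱ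
S-tableᴱ β₁  = ≋M-by-normalise refl
S-tableᴱ βₛ  = ≋M-by-normalise refl
S-tableᴱ βᵤ  = ≋M-by-normalise refl
S-tableᴱ βₛᵤ = ≋M-by-normalise refl

U-tableᴱ : ∀ β → AU *M basisᴱ β ≋M ⟦ timesU β ⟧ᴱ
U-tableᴱ β₁  = ≋M-by-normalise refl
U-tableᴱ βₛ  = ≋M-by-normalise refl
U-tableᴱ βᵤ  = ≋M-by-normalise refl
U-tableᴱ βₛᵤ = ≋M-by-normalise refl

U⁻¹-tableᴱ : ∀ β → AUinv *M basisᴱ β ≋M ⟦ timesU⁻¹ β ⟧ᴱ
U⁻¹-tableᴱ β₁  = ≋M-by-normalise refl
U⁻¹-tableᴱ βₛ  = ≋M-by-normalise refl
U⁻¹-tableᴱ βᵤ  = ≋M-by-normalise refl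
U⁻¹-tableᴱ βₛᵤ = ≋M-by-normalise refl

⟦⟧ᵗ-End : ∀ x → End-Eval.⟦ x ⟧ᵗ ≡ 𝒜₀ x
⟦⟧ᵗ-End S       = refl
⟦⟧ᵗ-End U       = refl
⟦⟧ᵗ-End U⁻¹     = refl
⟦⟧ᵗ-End 𝟘       = refl
⟦⟧ᵗ-End 𝟙       = refl
⟦⟧ᵗ-End (x ⊕ y) = cong₂ _+M_ (⟦⟧ᵗ-End x) (⟦⟧ᵗ-End y)
⟦⟧ᵗ-End (x ⊗ y) = cong₂ _*M_ (⟦⟧ᵗ-End x) (⟦⟧ᵗ-End y)
⟦⟧ᵗ-End (⊖ x)   = cong -M_ (⟦⟧ᵗ-End x)

decompose-correctᴱ : ∀ x → 𝒜₀ x ≋M ⟦ decompose x ⟧ᴱ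
decompose-correctᴱ x = ≡.subst (_≋M ⟦ decompose x ⟧ᴱ) (⟦⟧ᵗ-End x)
  (End-Eval.decompose-correct S-tableᴱ U-tableᴱ U⁻¹-tableᴱ x)

module ℤΛ-Eval = PolyEvaluation ℤΛ ξ₁ ξ₂ ξ₂⁻¹
open ℤΛ-Eval using () renaming (⟦_⟧ᵖ to ⟦_⟧ᴸ)

module _ where
  open Ring ℤΛ using (zeroʳ; +-identityʳ; +-identityˡ)

  diag-* : ∀ p q → diag p *M diag q ≋M diag (p *Λ q)
  diag-* p q = +-identityʳ (p *Λ q) , ≋-trans (+-identityʳ _) (zeroʳ p) ,
               zeroʳ p , +-identityˡ (p *Λ q)

  ⟦⟧ᵖ-diag : ∀ a → End-Eval.⟦ a ⟧ᵖ ≋M diag ⟦ a ⟧ᴸ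
  ⟦⟧ᵖ-diag 0ᵖ       = Ring.refl End
  ⟦⟧ᵖ-diag 1ᵖ       = Ring.refl End
  ⟦⟧ᵖ-diag ξ₁ᵖ      = Ring.refl End
  ⟦⟧ᵖ-diag ξ₂ᵖ      = Ring.refl End
  ⟦⟧ᵖ-diag ξ₂⁻¹ᵖ    = Ring.refl End
  ⟦⟧ᵖ-diag (a +ᵖ b) = Ring.+-cong End (⟦⟧ᵖ-diag a) (⟦⟧ᵖ-diag b)
  ⟦⟧ᵖ-diag (a *ᵖ b) = Ring.trans End (Ring.*-cong End (⟦⟧ᵖ-diag a) (⟦⟧ᵖ-diag b)) (diag-* ⟦ a ⟧ᴸ ⟦ b ⟧ᴸ)
  ⟦⟧ᵖ-diag (-ᵖ a)   = Ring.-‿cong End (⟦⟧ᵖ-diag a)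

  infixl 7 _·ˢ_
  _·ˢ_ : M2 → ZΛ → M2
  mat a b c d ·ˢ x = mat (a *Λ x) (b *Λ x) (c *Λ x) (d *Λ x)

  *M-diag : ∀ M x → M *M diag x ≋M M ·ˢ x
  *M-diag (mat a b c d) x = right-unit a b , left-unit a b , right-unit c d , left-unit c d
    where
    right-unit : ∀ a b → a *Λ x +Λ b *Λ 0Λ ≋ a *Λ x
    right-unit a b = ≋-trans (+Λ-congˡ (a *Λ x) (zeroʳ b)) (+-identityʳ (a *Λ x))
    left-unit : ∀ a b → a *Λ 0Λ +Λ b *Λ x ≋ b *Λ x
    left-unit a b = ≋-trans (+Λ-congʳ (b *Λ x) (zeroʳ a)) (+-identityˡ (b *Λ x))

  ·ˢ-congˡ : ∀ {M N} x → M ≋M N → M ·ˢ x ≋M N ·ˢ x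
  ·ˢ-congˡ x (p , q , r , s) = *Λ-congˡ x p , *Λ-congˡ x q , *Λ-congˡ x r , *Λ-congˡ x s

-- The entries of basisᴱ, simplified; e^{(-1,-1)} ξ₁² − 1 becomes the trinomial.
basisᶜ : Basis → M2
basisᶜ β₁  = 1M
basisᶜ βₛ  = minusDs
basisᶜ βᵤ  = mat ξ₁ trinomial (-Λ ξ₂) (-Λ ξ₁)
basisᶜ βₛᵤ = mat 0Λ 0Λ ξ₂ ξ₁

basis≋basisᶜ : ∀ β → basisᴱ β ≋M basisᶜ β
basis≋basisᶜ β₁  = ≋M-by-normalise refl
basis≋basisᶜ βₛ  = ≋M-by-normalise refl
basis≋basisᶜ βᵤ  = ≋M-by-normalise refl
basis≋basisᶜ βₛᵤ = ≋M-by-normalise refl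

module _ where
  open Ring ℤΛ using (*-identityˡ; +-identityʳ; +-congˡ; zeroʳ; *-congˡ; *-assoc; -‿cong)
  open import Algebra.Properties.Ring ℤΛ using (-1*x≈-x; -0#≈0#)
  open import Algebra.Properties.AbelianGroup ℤΛ-+-abelianGroup using (⁻¹-involutive)
  open import Relation.Binary.Reasoning.Setoid (Ring.setoid ℤΛ)

  basis-independent : ∀ X Y Z W →
    (((basisᶜ β₁ ·ˢ X) +M (basisᶜ βₛ ·ˢ Y)) +M (basisᶜ βᵤ ·ˢ Z)) +M (basisᶜ βₛᵤ ·ˢ W) ≋M 0M →
    X ≋ 0Λ × Y ≋ 0Λ × Z ≋ 0Λ × W ≋ 0Λ
  basis-independent X Y Z W (e₁₁ , e₁₂ , e₂₁ , e₂₂) = X≋0 , Y≋0 , Z≋0 , W≋0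
    where
    ·0 : ∀ a {x} → x ≋ 0Λ → a *Λ x ≋ 0Λ
    ·0 a x≋0 = ≋-trans (*-congˡ {a} x≋0) (zeroʳ a)

    Z≋0 : Z ≋ 0Λ
    Z≋0 = trinomial-regular Z (≋-trans (≋-sym (+-identityʳ _)) e₁₂)

    X≋0 : X ≋ 0Λ
    X≋0 = begin
      X                                          ≈⟨ ≋-trans (+-identityʳ _) (*-identityˡ X) ⟨
      1Λ *Λ X +Λ 0Λ                              ≈⟨ +-identityʳ _ ⟨
      1Λ *Λ X +Λ 0Λ +Λ 0Λ                        ≈⟨ +-congˡ (·0 ξ₁ Z≋0) ⟨
      1Λ *Λ X +Λ 0Λ +Λ ξ₁ *Λ Z                   ≈⟨ +-identityʳ _ ⟨
      1Λ *Λ X +Λ 0Λ +Λ ξ₁ *Λ Z +Λ 0Λ             ≈⟨ e₁₁ ⟩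
      0Λ                                         ∎

    W≋0 : W ≋ 0Λ
    W≋0 = begin
      W                                          ≈⟨ *-identityˡ W ⟨
      1Λ *Λ W                                    ≈⟨ *Λ-congˡ W (≋-by-normalise {1Λ} {ξ₂⁻¹ *Λ ξ₂} refl) ⟩
      ξ₂⁻¹ *Λ ξ₂ *Λ W                            ≈⟨ *-assoc ξ₂⁻¹ ξ₂ W ⟩
      ξ₂⁻¹ *Λ (ξ₂ *Λ W)                          ≈⟨ *Λ-congʳ ξ₂⁻¹ (+Λ-congʳ (ξ₂ *Λ W) (+Λ-congˡ (0Λ +Λ 0Λ) (·0 (-Λ ξ₂) Z≋0))) ⟨
      ξ₂⁻¹ *Λ (0Λ +Λ 0Λ +Λ (-Λ ξ₂) *Λ Z +Λ ξ₂ *Λ W) ≈⟨ ·0 ξ₂⁻¹ e₂₁ ⟩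
      0Λ                                         ∎

    Y≋0 : Y ≋ 0Λ
    Y≋0 = begin
      Y                                          ≈⟨ ⁻¹-involutive Y ⟨
      -Λ (-Λ Y)                                  ≈⟨ -‿cong (-1*x≈-x Y) ⟨
      -Λ ((-Λ 1Λ) *Λ Y)                          ≈⟨ -‿cong (ring-step) ⟩
      -Λ 0Λ                                      ≈⟨ -0#≈0# ⟩
      0Λ                                         ∎
      where
      ring-step : (-Λ 1Λ) *Λ Y ≋ 0Λ
      ring-step = begin
        (-Λ 1Λ) *Λ Y                                    ≈⟨ ≋-trans (+-identityʳ _) (+-identityʳ _) ⟨
        (-Λ 1Λ) *Λ Y +Λ 0Λ +Λ 0Λ                        ≈⟨ +Λ-cong (+Λ-congˡ ((-Λ 1Λ) *Λ Y) (·0 (-Λ ξ₁) Z≋0)) (·0 ξ₁ W≋0) ⟨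
        (-Λ 1Λ) *Λ Y +Λ (-Λ ξ₁) *Λ Z +Λ ξ₁ *Λ W        ≈⟨ ≋-refl ⟩
        0Λ +Λ (-Λ 1Λ) *Λ Y +Λ (-Λ ξ₁) *Λ Z +Λ ξ₁ *Λ W  ≈⟨ +Λ-congʳ (ξ₁ *Λ W) (+Λ-congʳ ((-Λ ξ₁) *Λ Z) (+Λ-congʳ ((-Λ 1Λ) *Λ Y) (·0 1Λ X≋0))) ⟨
        1Λ *Λ X +Λ (-Λ 1Λ) *Λ Y +Λ (-Λ ξ₁) *Λ Z +Λ ξ₁ *Λ W ≈⟨ e₂₂ ⟩
        0Λ                                              ∎

lincomb-diag : ∀ (f : Basis → ZΛ) → End-Eval.lincomb (λ β → diag (f β)) ≋M ∑ᵦ _+M_ (λ β → basisᶜ β ·ˢ f β)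
lincomb-diag f = End-Eval.∑ᵦ-cong (λ β → basisᴱ β *M diag (f β)) (λ β → basisᶜ β ·ˢ f β) λ β →
  Ring.trans End (*M-diag (basisᴱ β) (f β)) (·ˢ-congˡ {basisᴱ β} {basisᶜ β} (f β) (basis≋basisᶜ β))

coordinates-vanish : ∀ v → ⟦ v ⟧ᴱ ≋M 0M → ∀ β → ⟦ v β ⟧ᴸ ≋ 0Λ
coordinates-vanish v ⟦v⟧≋0 = pick (basis-independent _ _ _ _ combination≋0)
  where
  open Ring End using (sym; trans)
  combination≋0 : ∑ᵦ _+M_ (λ β → basisᶜ β ·ˢ ⟦ v β ⟧ᴸ) ≋M 0M
  combination≋0 = trans (sym (lincomb-diag (λ β → ⟦ v β ⟧ᴸ)))
    (trans (End-Eval.lincomb-cong _ _ (λ β → sym (⟦⟧ᵖ-diag (v β)))) ⟦v⟧≋0)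
  pick : ⟦ v β₁ ⟧ᴸ ≋ 0Λ × ⟦ v βₛ ⟧ᴸ ≋ 0Λ × ⟦ v βᵤ ⟧ᴸ ≋ 0Λ × ⟦ v βₛᵤ ⟧ᴸ ≋ 0Λ → ∀ β → ⟦ v β ⟧ᴸ ≋ 0Λ
  pick (X≋0 , _ , _ , _) β₁  = X≋0
  pick (_ , Y≋0 , _ , _) βₛ  = Y≋0
  pick (_ , _ , Z≋0 , _) βᵤ  = Z≋0
  pick (_ , _ , _ , W≋0) βₛᵤ = W≋0

-- From ℤ[Λ] back to the centre of ℋ(0)

module _ where
  open ℋ-Properties
  open import Data.Integer using (_⊖_)
  open import Algebra.Definitions.RawMonoid (Ring.+-rawMonoid ℋ) using () renaming (_×_ to _×ₘ_)
  open import Algebra.Properties.Monoid.Mult (Ring.+-monoid ℋ) using (×-homo-+)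

  ι : ℤ → HTerm
  ι (+ n)    = n ×ₘ 𝟙
  ι -[1+ n ] = ⊖ (suc n ×ₘ 𝟙)

  ι-⊖ : ∀ m n → ι (m ⊖ n) ∼ m ×ₘ 𝟙 ⊕ ⊖ (n ×ₘ 𝟙)
  ι-⊖ zero    zero    = ∼-sym (-‿inverseʳ 𝟘)
  ι-⊖ zero    (suc n) = ∼-sym (⊕-identityˡ _)
  ι-⊖ (suc m) zero    = ∼-sym (∼-trans (+-congˡ ε⁻¹≈ε) (+-identityʳ _))
  ι-⊖ (suc m) (suc n) = begin
    ι (suc m ⊖ suc n)                   ≡⟨ cong ι (ℤ.[1+m]⊖[1+n]≡m⊖n m n) ⟩
    ι (m ⊖ n)                           ≈⟨ ι-⊖ m n ⟩
    m ×ₘ 𝟙 ⊕ ⊖ (n ×ₘ 𝟙)                 ≈⟨ ⊕-identityˡ _ ⟨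
    𝟘 ⊕ (m ×ₘ 𝟙 ⊕ ⊖ (n ×ₘ 𝟙))           ≈⟨ +-congʳ (-‿inverseʳ 𝟙) ⟨
    𝟙 ⊕ ⊖ 𝟙 ⊕ (m ×ₘ 𝟙 ⊕ ⊖ (n ×ₘ 𝟙))     ≈⟨ interchange 𝟙 (⊖ 𝟙) (m ×ₘ 𝟙) (⊖ (n ×ₘ 𝟙)) ⟩
    𝟙 ⊕ m ×ₘ 𝟙 ⊕ (⊖ 𝟙 ⊕ ⊖ (n ×ₘ 𝟙))     ≈⟨ +-congˡ (⁻¹-∙-comm 𝟙 (n ×ₘ 𝟙)) ⟩
    𝟙 ⊕ m ×ₘ 𝟙 ⊕ ⊖ (𝟙 ⊕ n ×ₘ 𝟙)         ∎

  ι-+ : ∀ c d → ι (c +ℤ d) ∼ ι c ⊕ ι d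
  ι-+ (+ m)    (+ n)    = ×-homo-+ 𝟙 m n
  ι-+ (+ m)    -[1+ n ] = ι-⊖ m (suc n)
  ι-+ -[1+ m ] (+ n)    = ∼-trans (ι-⊖ n (suc m)) (⊕-comm _ _)
  ι-+ -[1+ m ] -[1+ n ] = begin
    ⊖ (suc (suc (m ℕ.+ n)) ×ₘ 𝟙)        ≡⟨ cong (λ k → ⊖ (suc k ×ₘ 𝟙)) (ℕ.+-suc m n) ⟨
    ⊖ ((suc m ℕ.+ suc n) ×ₘ 𝟙)          ≈⟨ ⊖-cong (×-homo-+ 𝟙 (suc m) (suc n)) ⟩
    ⊖ (suc m ×ₘ 𝟙 ⊕ suc n ×ₘ 𝟙)         ≈⟨ ⁻¹-∙-comm _ _ ⟨
    ⊖ (suc m ×ₘ 𝟙) ⊕ ⊖ (suc n ×ₘ 𝟙)     ∎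

  open import Algebra.Definitions.RawSemiring (Semiring.rawSemiring (Ring.semiring ℋ)) using (_^_)

  z₂z₂⁻¹x∼x : ∀ x → z₂ ⊗ (z₂⁻¹ ⊗ x) ∼ x
  z₂z₂⁻¹x∼x x = ∼-trans (∼-sym (⊗-assoc _ _ _)) (∼-trans (*-congʳ z₂z₂⁻¹∼𝟙) (⊗-identityˡ x))

  z₂⁻¹z₂x∼x : ∀ x → z₂⁻¹ ⊗ (z₂ ⊗ x) ∼ x
  z₂⁻¹z₂x∼x x = ∼-trans (∼-sym (⊗-assoc _ _ _)) (∼-trans (*-congʳ z₂⁻¹z₂∼𝟙) (⊗-identityˡ x))

  z₂^ : ℤ → HTerm
  z₂^ (+ n)    = z₂ ^ n
  z₂^ -[1+ n ] = z₂⁻¹ ^ suc n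

  z₂^-suc : ∀ b → z₂^ (+ 1 +ℤ b) ∼ z₂ ⊗ z₂^ b
  z₂^-suc (+ n)          = ∼-refl
  z₂^-suc -[1+ zero ]    = ∼-sym (z₂z₂⁻¹x∼x 𝟙)
  z₂^-suc -[1+ suc n ]   = ∼-sym (z₂z₂⁻¹x∼x _)

  z₂^-pred : ∀ b → z₂^ (-[1+ 0 ] +ℤ b) ∼ z₂⁻¹ ⊗ z₂^ b
  z₂^-pred (+ zero)  = ∼-refl
  z₂^-pred (+ suc n) = ∼-sym (z₂⁻¹z₂x∼x _)
  z₂^-pred -[1+ n ]  = ∼-refl

  -- h (k + 1) = step-up (h k) (h (k - 1)) for k ≥ 0 and h (k - 1) = step-down (h k) (h (k + 1)) for k < 0.
  step-up step-down : HTerm → HTerm → HTerm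
  step-up   x y = z₁ ⊗ x ⊕ ⊖ (z₂ ⊗ y)
  step-down x y = z₂⁻¹ ⊗ (z₁ ⊗ x ⊕ ⊖ y)

  h≥0 h<0 : ℕ → HTerm
  h≥0 zero          = 𝟙
  h≥0 (suc zero)    = step-up 𝟙 𝟘
  h≥0 (suc (suc n)) = step-up (h≥0 (suc n)) (h≥0 n)
  h<0 zero          = 𝟘
  h<0 (suc zero)    = step-down 𝟘 𝟙
  h<0 (suc (suc n)) = step-down (h<0 (suc n)) (h<0 n)

  h : ℤ → HTerm
  h (+ n)    = h≥0 n
  h -[1+ n ] = h<0 n

  step-up-correct : ∀ x y → step-up x y ⊕ z₂ ⊗ y ∼ z₁ ⊗ x
  step-up-correct x y = //-rightDividesˡ (z₂ ⊗ y) (z₁ ⊗ x)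

  step-down-correct : ∀ x y → y ⊕ z₂ ⊗ step-down x y ∼ z₁ ⊗ x
  step-down-correct x y = begin
    y ⊕ z₂ ⊗ (z₂⁻¹ ⊗ (z₁ ⊗ x ⊕ ⊖ y))     ≈⟨ +-congˡ (z₂z₂⁻¹x∼x _) ⟩
    y ⊕ (z₁ ⊗ x ⊕ ⊖ y)                   ≈⟨ ⊕-comm _ _ ⟩
    z₁ ⊗ x ⊕ ⊖ y ⊕ y                     ≈⟨ //-rightDividesˡ y (z₁ ⊗ x) ⟩
    z₁ ⊗ x                               ∎

  h-recurrence : ∀ k → h (+ 1 +ℤ k) ⊕ z₂ ⊗ h (-[1+ 0 ] +ℤ k) ∼ z₁ ⊗ h k
  h-recurrence (+ zero)     = step-up-correct 𝟙 𝟘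
  h-recurrence (+ suc n)    = step-up-correct (h≥0 (suc n)) (h≥0 n)
  h-recurrence -[1+ zero ]  = step-down-correct 𝟘 𝟙
  h-recurrence -[1+ suc n ] = step-down-correct (h<0 (suc n)) (h<0 n)

  Q : Exp → HTerm
  Q (a , b) = z₂^ b ⊗ h (a -ℤ b)

  module Linear (G : Exp → HTerm) =
    Extension (Ring.+-abelianGroup ℋ) (λ c e → ι c ⊗ G e)
              (λ c d e → ∼-trans (*-congʳ (ι-+ c d)) (distribʳ (G e) (ι c) (ι d)))

  linear : (Exp → HTerm) → ZΛ → HTerm
  linear G = Linear.extend G

  linear-cong : ∀ {G G′} → (∀ e → G e ∼ G′ e) → ∀ p → linear G p ∼ linear G′ p
  linear-cong G∼G′ []            = ∼-refl
  linear-cong G∼G′ ((c , e) ∷ p) = ⊕-cong (*-congˡ (G∼G′ e)) (linear-cong G∼G′ p)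

  linear-⊕ : ∀ G G′ p → linear (λ e → G e ⊕ G′ e) p ∼ linear G p ⊕ linear G′ p
  linear-⊕ G G′ []            = ∼-sym (+-identityʳ 𝟘)
  linear-⊕ G G′ ((c , e) ∷ p) = begin
    ι c ⊗ (G e ⊕ G′ e) ⊕ linear (λ e → G e ⊕ G′ e) p
      ≈⟨ ⊕-cong (distribˡ (ι c) (G e) (G′ e)) (linear-⊕ G G′ p) ⟩
    ι c ⊗ G e ⊕ ι c ⊗ G′ e ⊕ (linear G p ⊕ linear G′ p)
      ≈⟨ interchange _ _ _ _ ⟩
    ι c ⊗ G e ⊕ linear G p ⊕ (ι c ⊗ G′ e ⊕ linear G′ p) ∎

  linear-central : ∀ g G → Central g → ∀ p → linear (λ e → g ⊗ G e) p ∼ g ⊗ linear G p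
  linear-central g G g-central []            = ∼-sym (zeroʳ g)
  linear-central g G g-central ((c , e) ∷ p) = begin
    ι c ⊗ (g ⊗ G e) ⊕ linear (λ e → g ⊗ G e) p   ≈⟨ ⊕-cong (∼-sym (⊗-assoc _ _ _)) (linear-central g G g-central p) ⟩
    ι c ⊗ g ⊗ G e ⊕ g ⊗ linear G p               ≈⟨ +-congʳ (*-congʳ (∼-sym (g-central (ι c)))) ⟩
    g ⊗ ι c ⊗ G e ⊕ g ⊗ linear G p               ≈⟨ +-congʳ (⊗-assoc _ _ _) ⟩
    g ⊗ (ι c ⊗ G e) ⊕ g ⊗ linear G p             ≈⟨ distribˡ g _ _ ⟨
    g ⊗ (ι c ⊗ G e ⊕ linear G p)                 ∎

  linear-shift : ∀ G v q → linear G (map ((+ 1 , v) ·ₘ_) q) ∼ linear (λ e → G (v +E e)) q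
  linear-shift G v []            = ∼-refl
  linear-shift G v ((d , e) ∷ q) =
    ⊕-cong (*-congʳ (reflexive (cong ι (ℤ.*-identityˡ d)))) (linear-shift G v q)

  Q-ξ₂ : ∀ e → Q ((+ 1 , + 1) +E e) ∼ z₂ ⊗ Q e
  Q-ξ₂ (a , b) = ∼-trans (⊗-cong (z₂^-suc b) (reflexive (cong h (shift a b)))) (⊗-assoc _ _ _)
    where shift : ∀ a b → (+ 1 +ℤ a) -ℤ (+ 1 +ℤ b) ≡ a -ℤ b
          shift = solve-∀

  Q-ξ₂⁻¹ : ∀ e → Q ((-[1+ 0 ] , -[1+ 0 ]) +E e) ∼ z₂⁻¹ ⊗ Q e
  Q-ξ₂⁻¹ (a , b) = ∼-trans (⊗-cong (z₂^-pred b) (reflexive (cong h (shift a b)))) (⊗-assoc _ _ _)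
    where shift : ∀ a b → (-[1+ 0 ] +ℤ a) -ℤ (-[1+ 0 ] +ℤ b) ≡ a -ℤ b
          shift = solve-∀

  Q-ξ₁ : ∀ e → Q ((+ 1 , + 0) +E e) ⊕ Q ((+ 0 , + 1) +E e) ∼ z₁ ⊗ Q e
  Q-ξ₁ (a , b) = begin
    z₂^ (+ 0 +ℤ b) ⊗ h (+ 1 +ℤ a -ℤ (+ 0 +ℤ b)) ⊕ z₂^ (+ 1 +ℤ b) ⊗ h (+ 0 +ℤ a -ℤ (+ 1 +ℤ b))
      ≈⟨ ⊕-cong (⊗-cong (reflexive (cong z₂^ (ℤ.+-identityˡ b))) (reflexive (cong h (shift₁ a b))))
                (⊗-cong (z₂^-suc b) (reflexive (cong h (shift₂ a b)))) ⟩
    z₂^ b ⊗ h (+ 1 +ℤ k) ⊕ z₂ ⊗ z₂^ b ⊗ h (-[1+ 0 ] +ℤ k)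
      ≈⟨ +-congˡ (∼-trans (*-congʳ (z₂-central (z₂^ b))) (⊗-assoc _ _ _)) ⟩
    z₂^ b ⊗ h (+ 1 +ℤ k) ⊕ z₂^ b ⊗ (z₂ ⊗ h (-[1+ 0 ] +ℤ k))
      ≈⟨ distribˡ (z₂^ b) _ _ ⟨
    z₂^ b ⊗ (h (+ 1 +ℤ k) ⊕ z₂ ⊗ h (-[1+ 0 ] +ℤ k))
      ≈⟨ *-congˡ (h-recurrence k) ⟩
    z₂^ b ⊗ (z₁ ⊗ h k)
      ≈⟨ ∼-trans (∼-sym (⊗-assoc _ _ _)) (∼-trans (*-congʳ (∼-sym (z₁-central (z₂^ b)))) (⊗-assoc _ _ _)) ⟩
    z₁ ⊗ (z₂^ b ⊗ h k) ∎
    where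
    k : ℤ
    k = a -ℤ b
    shift₁ : ∀ a b → + 1 +ℤ a -ℤ (+ 0 +ℤ b) ≡ + 1 +ℤ (a -ℤ b)
    shift₁ = solve-∀
    shift₂ : ∀ a b → + 0 +ℤ a -ℤ (+ 1 +ℤ b) ≡ -[1+ 0 ] +ℤ (a -ℤ b)
    shift₂ = solve-∀

  α : ZΛ → HTerm
  α = linear Q

  α-1Λ : α 1Λ ∼ 𝟙
  α-1Λ = ∼-trans (+-identityʳ _) (∼-trans (⊗-cong (+-identityʳ 𝟙) (⊗-identityˡ 𝟙)) (⊗-identityˡ 𝟙))

  α-shift : ∀ g v → Central g → (∀ e → Q (v +E e) ∼ g ⊗ Q e) → ∀ q → α (map ((+ 1 , v) ·ₘ_) q) ∼ g ⊗ α q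
  α-shift g v g-central Q-shift q = begin
    α (map ((+ 1 , v) ·ₘ_) q)         ≈⟨ linear-shift Q v q ⟩
    linear (λ e → Q (v +E e)) q       ≈⟨ linear-cong Q-shift q ⟩
    linear (λ e → g ⊗ Q e) q          ≈⟨ linear-central g Q g-central q ⟩
    g ⊗ α q                           ∎

  α-⟦⟧ : ∀ c q → α (⟦ c ⟧ᴸ *Λ q) ∼ ⟦ c ⟧ᵖᴴ ⊗ α q
  α-⟦⟧ 0ᵖ       q = ∼-sym (zeroˡ (α q))
  α-⟦⟧ 1ᵖ       q = ∼-trans (reflexive (cong α (*Λ-identityˡ q))) (∼-sym (⊗-identityˡ (α q)))
  α-⟦⟧ ξ₁ᵖ      q = begin
    α (map t₁ q ++ (map t₂ q ++ []))        ≈⟨ Linear.extend-+Λ Q (map t₁ q) _ ⟩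
    α (map t₁ q) ⊕ α (map t₂ q ++ [])       ≈⟨ +-congˡ (reflexive (cong α (List.++-identityʳ (map t₂ q)))) ⟩
    α (map t₁ q) ⊕ α (map t₂ q)             ≈⟨ ⊕-cong (linear-shift Q (+ 1 , + 0) q) (linear-shift Q (+ 0 , + 1) q) ⟩
    linear (λ e → Q ((+ 1 , + 0) +E e)) q ⊕ linear (λ e → Q ((+ 0 , + 1) +E e)) q
                                            ≈⟨ linear-⊕ _ _ q ⟨
    linear (λ e → Q ((+ 1 , + 0) +E e) ⊕ Q ((+ 0 , + 1) +E e)) q
                                            ≈⟨ linear-cong Q-ξ₁ q ⟩
    linear (λ e → z₁ ⊗ Q e) q               ≈⟨ linear-central z₁ Q z₁-central q ⟩
    z₁ ⊗ α q                                ∎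
    where
    t₁ t₂ : ℤ × Exp → ℤ × Exp
    t₁ = (+ 1 , (+ 1 , + 0)) ·ₘ_
    t₂ = (+ 1 , (+ 0 , + 1)) ·ₘ_
  α-⟦⟧ ξ₂ᵖ      q = ∼-trans (reflexive (cong α (List.++-identityʳ (map ((+ 1 , (+ 1 , + 1)) ·ₘ_) q))))
                             (α-shift z₂ (+ 1 , + 1) z₂-central Q-ξ₂ q)
  α-⟦⟧ ξ₂⁻¹ᵖ    q = ∼-trans (reflexive (cong α (List.++-identityʳ (map ((+ 1 , (-[1+ 0 ] , -[1+ 0 ])) ·ₘ_) q))))
                             (α-shift z₂⁻¹ (-[1+ 0 ] , -[1+ 0 ]) z₂⁻¹-central Q-ξ₂⁻¹ q)
  α-⟦⟧ (a +ᵖ b) q = begin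
    α ((⟦ a ⟧ᴸ +Λ ⟦ b ⟧ᴸ) *Λ q)              ≡⟨ cong α (*Λ-distribʳ ⟦ a ⟧ᴸ ⟦ b ⟧ᴸ q) ⟩
    α (⟦ a ⟧ᴸ *Λ q +Λ ⟦ b ⟧ᴸ *Λ q)           ≈⟨ Linear.extend-+Λ Q (⟦ a ⟧ᴸ *Λ q) _ ⟩
    α (⟦ a ⟧ᴸ *Λ q) ⊕ α (⟦ b ⟧ᴸ *Λ q)        ≈⟨ ⊕-cong (α-⟦⟧ a q) (α-⟦⟧ b q) ⟩
    ⟦ a ⟧ᵖᴴ ⊗ α q ⊕ ⟦ b ⟧ᵖᴴ ⊗ α q             ≈⟨ distribʳ (α q) _ _ ⟨
    (⟦ a ⟧ᵖᴴ ⊕ ⟦ b ⟧ᵖᴴ) ⊗ α q                 ∎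
  α-⟦⟧ (a *ᵖ b) q = begin
    α (⟦ a ⟧ᴸ *Λ ⟦ b ⟧ᴸ *Λ q)                ≡⟨ cong α (*Λ-assoc ⟦ a ⟧ᴸ ⟦ b ⟧ᴸ q) ⟩
    α (⟦ a ⟧ᴸ *Λ (⟦ b ⟧ᴸ *Λ q))              ≈⟨ α-⟦⟧ a _ ⟩
    ⟦ a ⟧ᵖᴴ ⊗ α (⟦ b ⟧ᴸ *Λ q)                 ≈⟨ *-congˡ (α-⟦⟧ b q) ⟩
    ⟦ a ⟧ᵖᴴ ⊗ (⟦ b ⟧ᵖᴴ ⊗ α q)                 ≈⟨ ⊗-assoc _ _ _ ⟨
    ⟦ a ⟧ᵖᴴ ⊗ ⟦ b ⟧ᵖᴴ ⊗ α q                   ∎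
  α-⟦⟧ (-ᵖ a)   q = begin
    α ((-Λ ⟦ a ⟧ᴸ) *Λ q)                     ≈⟨ Linear.extend-cong Q (≋-sym (-‿distribˡ-*ᴸ ⟦ a ⟧ᴸ q)) ⟩
    α (-Λ (⟦ a ⟧ᴸ *Λ q))                     ≈⟨ Linear.extend--Λ Q (⟦ a ⟧ᴸ *Λ q) ⟩
    ⊖ α (⟦ a ⟧ᴸ *Λ q)                        ≈⟨ ⊖-cong (α-⟦⟧ a q) ⟩
    ⊖ (⟦ a ⟧ᵖᴴ ⊗ α q)                        ≈⟨ -‿distribˡ-* _ _ ⟩
    ⊖ ⟦ a ⟧ᵖᴴ ⊗ α q                          ∎
    where open import Algebra.Properties.Ring ℤΛ using () renaming (-‿distribˡ-* to -‿distribˡ-*ᴸ)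

  ⟦⟧ᴸ≋0⇒⟦⟧ᴴ∼0 : ∀ c → ⟦ c ⟧ᴸ ≋ 0Λ → ⟦ c ⟧ᵖᴴ ∼ 𝟘
  ⟦⟧ᴸ≋0⇒⟦⟧ᴴ∼0 c c≋0 = begin
    ⟦ c ⟧ᵖᴴ                   ≈⟨ ⊗-identityʳ _ ⟨
    ⟦ c ⟧ᵖᴴ ⊗ 𝟙               ≈⟨ *-congˡ α-1Λ ⟨
    ⟦ c ⟧ᵖᴴ ⊗ α 1Λ            ≈⟨ α-⟦⟧ c 1Λ ⟨
    α (⟦ c ⟧ᴸ *Λ 1Λ)          ≈⟨ Linear.extend-cong Q (*Λ-congˡ 1Λ c≋0) ⟩
    α (0Λ *Λ 1Λ)              ≡⟨⟩
    𝟘                         ∎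

≈M⇒≋M : ∀ {M N} → M ≈M N → M ≋M N
≈M⇒≋M (p , q , r , s) = coeffwise p , coeffwise q , coeffwise r , coeffwise s

coordinates-faithful : ∀ v w → ⟦ v ⟧ᴱ ≋M ⟦ w ⟧ᴱ → ⟦ v ⟧ᴴ ∼ ⟦ w ⟧ᴴ
coordinates-faithful v w ⟦v⟧≋⟦w⟧ = x∙y⁻¹≈ε⇒x≈y ⟦ v ⟧ᴴ ⟦ w ⟧ᴴ (begin
  ⟦ v ⟧ᴴ ⊕ ⊖ ⟦ w ⟧ᴴ         ≈⟨ ℋ-Eval.⟦⊟⟧ v w ⟨
  ⟦ v ⊟ w ⟧ᴴ                 ≈⟨ ℋ-Eval.lincomb-cong _ (λ _ → 𝟘) coordinate∼0 ⟩
  ℋ-Eval.lincomb (λ _ → 𝟘)  ≈⟨ ℋ-Eval.lincomb-zero ⟩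
  𝟘                          ∎)
  where
  open ℋ-Properties
  open import Algebra.Properties.AbelianGroup (Ring.+-abelianGroup End) using (x≈y⇒x∙y⁻¹≈ε)
  ⟦v⊟w⟧≋0 : ⟦ v ⊟ w ⟧ᴱ ≋M 0M
  ⟦v⊟w⟧≋0 = Ring.trans End (End-Eval.⟦⊟⟧ v w) (x≈y⇒x∙y⁻¹≈ε ⟦v⟧≋⟦w⟧)
  coordinate∼0 : ∀ β → ⟦ (v ⊟ w) β ⟧ᵖᴴ ∼ 𝟘
  coordinate∼0 β = ⟦⟧ᴸ≋0⇒⟦⟧ᴴ∼0 ((v ⊟ w) β) (coordinates-vanish (v ⊟ w) ⟦v⊟w⟧≋0 β)

mainTheorem3 : ∀ (x y : HTerm) → 𝒜₀ x ≈M 𝒜₀ y → x ∼ y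
mainTheorem3 x y 𝒜₀x≈𝒜₀y = begin
  x                   ≈⟨ decompose-correctᴴ x ⟩
  ⟦ decompose x ⟧ᴴ    ≈⟨ coordinates-faithful (decompose x) (decompose y) ⟦x⟧≋⟦y⟧ ⟩
  ⟦ decompose y ⟧ᴴ    ≈⟨ decompose-correctᴴ y ⟨
  y                   ∎
  where
  open ℋ-Properties
  open Ring End using (sym; trans)
  ⟦x⟧≋⟦y⟧ : ⟦ decompose x ⟧ᴱ ≋M ⟦ decompose y ⟧ᴱ
  ⟦x⟧≋⟦y⟧ = trans (sym (decompose-correctᴱ x)) (trans (≈M⇒≋M 𝒜₀x≈𝒜₀y) (decompose-correctᴱ y))
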